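{- Let $q,r'\in\mathbb{N}$ and $r\in\mathbb{N}_0$ with $q>r$ and $r'\ge r$, and let $\varepsilon,d,\xi,\gamma\ge 0$. Let $G$ be a complex on $n\ge r2^{r+1}$ vertices and let $H$ be an $r'$-graph on $V(G)$ with $\Delta(H)\le\gamma n$. Then: (i) if $G$ is $(\varepsilon,d,q,r)$-regular, then $G-H$ is $(\varepsilon+2^r\gamma,d,q,r)$-regular; (ii) if $G$ is $(\xi,q,r)$-dense, then $G-H$ is $(\xi-2^r\gamma,q,r)$-dense; (iii) if $G$ is $(\xi,q,r)$-extendable, then $G-H$ is $(\xi-2^r\gamma,q,r)$-extendable; (iv) if $G$ is an $(\varepsilon,\xi,q,r)$-complex, then $G-H$ is an $(\varepsilon+2^r\gamma,\xi-2^r\gamma,q,r)$-complex; (v) if $G$ is an $(\varepsilon,\xi,q,r)$-supercomplex, then $G-H$ is an $(\varepsilon+2^{2r+1}\gamma,\xi-2^{2r+1}\gamma,q,r)$-supercomplex.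
   Context: A complex is a hypergraph $G$ closed under taking subsets; $G$ is empty if $\emptyset\notin G$; $G^{(i)}$ is the $i$-graph on $V(G)$ of edges of size $i$. For an $r'$-graph $H$ on $V(G)$, $G-H$ is the complex on $V(G)$ consisting of all edges of $G$ that contain no edge of $H$. For an $r'$-graph $H$ and a set $S$, $H(S)$ is the set of sets $f$ with $S\cup f\in H$; $\Delta(H)$ is the maximum of $|H(S)|$ over $(r'-1)$-sets $S$. For $e\subseteq V(G)$, $G(e)$ is the complex on $V(G)\setminus e$ of all $f$ with $e\cup f\in G$; for $e\in G^{(r)}$, $G^{(q)}(e)$ is the set of $(q-r)$-sets $f$ with $e\cup f\in G$. Intersections of complexes are on the intersection of vertex sets. For a $q$-graph $Y$ on $V(G)$, $G[Y]$ is the complex of all $e\in G$ all of whose $q$-subsets lie in $Y$. $a=b\pm c$ means $b-c\le a\le b+c$. For a complex $G$ on $n$ vertices, $q\in\mathbb{N}$, $r\in\{0,\dots,q-1\}$: $(\varepsilon,d,q,r)$-regular: $|G^{(q)}(e)|=(d\pm\varepsilon)n^{q-r}$ for all $e\in G^{(r)}$; $(\xi,q,r)$-dense: $|G^{(q)}(e)|\ge\xi n^{q-r}$ for all $e\in G^{(r)}$; $(\xi,q,r)$-extendable: $G^{(r)}$ empty or some $X\subseteq V(G)$ with $|X|\ge\xi n$ is such that every $r$-subset $e$ of $X$ has at least $\xi n^{q-r}$ $(q-r)$-sets $Q\subseteq V(G)\setminus e$ with $\binom{Q\cup e}{r}\setminus\{e\}\subseteq G^{(r)}$. Full $(\varepsilon,\xi,q,r)$-complex: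 $(\varepsilon,d,q,r)$-regular for some $d\ge\xi$, $(\xi,q+r,r)$-dense, $(\xi,q,r)$-extendable. $(\varepsilon,\xi,q,r)$-complex: $G[Y]$ is a full $(\varepsilon,\xi,q,r)$-complex for some $q$-graph $Y$ on $V(G)$. $(\varepsilon,\xi,q,r)$-supercomplex: for all $i\in\{0,\dots,r\}$ and $F\subseteq G^{(i)}$ with $1\le|F|\le2^i$, $\bigcap_{f\in F}G(f)$ is an $(\varepsilon,\xi,q-i,r-i)$-complex.
   Formalization: The parameters ε, d, ξ, γ, and the d in the definition of a full complex, are rational. -}

module Defs where

open import Data.Bool using (Bool; true; false; _∧_; _∨_; not; if_then_else_)
open import Data.Nat as ℕ using (ℕ; zero; suc; _∸_; _^_)
open import Data.Integer using (+_)
open import Data.Rational using (ℚ; _/_; _≤_; _+_; _-_; _*_)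
open import Data.List using (List; []; _∷_; map; _++_; length; foldr)
open import Data.Bool.ListAction using (all; any)
import Data.Vec as Vec
open import Data.Fin.Subset using (Subset; _⊆_; _∪_; _∩_; _─_; ∣_∣; outside; inside; ⊤)
open import Data.Fin.Subset.Properties using (_⊆?_)
open import Data.Product using (Σ; _×_)
open import Data.Sum using (_⊎_)
open import Relation.Nullary using (¬_)
open import Relation.Nullary.Decidable using (⌊_⌋)
open import Relation.Binary.PropositionalEquality using (_≡_)

-- A complex carries its vertex set V ⊆ Fin N explicitly (because G(e) and
-- intersections change the vertex set); "n" is always ∣ V ∣.

allSubsets : (N : ℕ) → List (Subset N)
allSubsets zero = Vec.[] ∷ []
allSubsets (suc N) = map (outside Vec.∷_) (allSubsets N) ++ map (inside Vec.∷_) (allSubsets N)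

count : {N : ℕ} → (Subset N → Bool) → ℕ
count {N} P = foldr (λ x acc → if P x then suc acc else acc) 0 (allSubsets N)

_⊆ᵇ_ : {N : ℕ} → Subset N → Subset N → Bool
e ⊆ᵇ f = ⌊ e ⊆? f ⌋

_=ᵇ_ : {N : ℕ} → Subset N → Subset N → Bool
e =ᵇ f = (e ⊆ᵇ f) ∧ (f ⊆ᵇ e)

size=ᵇ : {N : ℕ} → Subset N → ℕ → Bool
size=ᵇ e k = ⌊ ∣ e ∣ ℕ.≟ k ⌋

ℕ→ℚ : ℕ → ℚ
ℕ→ℚ n = + n / 1

record Cx (N : ℕ) : Set where
  constructor mkCx
  field
    V   : Subset N
    mem : Subset N → Bool
open Cx public

nV : {N : ℕ} → Cx N → ℕ
nV G = ∣ V G ∣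

Edge : {N : ℕ} → Cx N → Subset N → Set
Edge G e = (mem G e ≡ true) × (e ⊆ V G)

IsComplex : {N : ℕ} → Cx N → Set
IsComplex G = (∀ e → mem G e ≡ true → e ⊆ V G)
            × (∀ e f → mem G e ≡ true → f ⊆ e → mem G f ≡ true)

IsGraphOn : {N : ℕ} → ℕ → (Subset N → Bool) → Subset N → Set
IsGraphOn k H W = ∀ e → H e ≡ true → (e ⊆ W) × (∣ e ∣ ≡ k)

-- |G^{(|e|+k)}(e)| : number of k-sets f ⊆ V(G) ∖ e with e ∪ f ∈ G
upDeg : {N : ℕ} → Cx N → ℕ → Subset N → ℕ
upDeg G k e = count (λ f → (f ⊆ᵇ (V G ─ e)) ∧ size=ᵇ f k ∧ mem G (e ∪ f))

-- Δ(H) ≤ γ n, for an r'-graph H on W, n = |W|: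
-- every (r'-1)-set S ⊆ W has |H(S)| ≤ γ n, where H(S) = {f ⊆ W ∖ S : S ∪ f ∈ H}
MaxDegLe : {N : ℕ} → ℕ → (Subset N → Bool) → Subset N → ℚ → Set
MaxDegLe r' H W γ = ∀ S → S ⊆ W → ∣ S ∣ ≡ r' ∸ 1 →
  ℕ→ℚ (count (λ f → (f ⊆ᵇ (W ─ S)) ∧ H (S ∪ f))) ≤ γ * ℕ→ℚ ∣ W ∣

_minus_ : {N : ℕ} → Cx N → (Subset N → Bool) → Cx N
_minus_ {N} G H = mkCx (V G) (λ e → mem G e ∧ not (any (λ f → (f ⊆ᵇ e) ∧ H f) (allSubsets N)))

link : {N : ℕ} → Cx N → Subset N → Cx N
link G f = mkCx (V G ─ f) (λ e → mem G (f ∪ e) ∧ (e ⊆ᵇ (V G ─ f)))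

_⊓_ : {N : ℕ} → Cx N → Cx N → Cx N
G₁ ⊓ G₂ = mkCx (V G₁ ∩ V G₂) (λ e → mem G₁ e ∧ mem G₂ e ∧ (e ⊆ᵇ (V G₁ ∩ V G₂)))

-- intersection of a (nonempty) list of complexes; only used on nonempty lists
⨅ : {N : ℕ} → List (Cx N) → Cx N
⨅ [] = mkCx ⊤ (λ _ → true)
⨅ (G ∷ []) = G
⨅ (G ∷ Gs@(_ ∷ _)) = G ⊓ ⨅ Gs

restrict : {N : ℕ} → Cx N → ℕ → (Subset N → Bool) → Cx N
restrict {N} G q Y = mkCx (V G) (λ e → mem G e ∧
  all (λ g → not ((g ⊆ᵇ e) ∧ size=ᵇ g q) ∨ Y g) (allSubsets N))

_^ℚ_ : ℕ → ℕ → ℚ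
n ^ℚ k = ℕ→ℚ (n ^ k)

Regular : {N : ℕ} → ℚ → ℚ → ℕ → ℕ → Cx N → Set
Regular ε d q r G = ∀ e → Edge G e → ∣ e ∣ ≡ r →
  ((d - ε) * (nV G ^ℚ (q ∸ r)) ≤ ℕ→ℚ (upDeg G (q ∸ r) e))
  × (ℕ→ℚ (upDeg G (q ∸ r) e) ≤ (d + ε) * (nV G ^ℚ (q ∸ r)))

Dense : {N : ℕ} → ℚ → ℕ → ℕ → Cx N → Set
Dense ξ q r G = ∀ e → Edge G e → ∣ e ∣ ≡ r →
  ξ * (nV G ^ℚ (q ∸ r)) ≤ ℕ→ℚ (upDeg G (q ∸ r) e)

extCount : {N : ℕ} → Cx N → ℕ → ℕ → Subset N → ℕ
extCount {N} G q r e = count (λ Q → (Q ⊆ᵇ (V G ─ e)) ∧ size=ᵇ Q (q ∸ r) ∧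
  all (λ g → not ((g ⊆ᵇ (Q ∪ e)) ∧ size=ᵇ g r ∧ not (g =ᵇ e))
             ∨ (mem G g ∧ (g ⊆ᵇ V G)))
      (allSubsets N))

Extendable : {N : ℕ} → ℚ → ℕ → ℕ → Cx N → Set
Extendable ξ q r G =
  (∀ e → Edge G e → ¬ (∣ e ∣ ≡ r))
  ⊎ Σ _ (λ X → (X ⊆ V G) × (ξ * ℕ→ℚ (nV G) ≤ ℕ→ℚ ∣ X ∣)
       × (∀ e → e ⊆ X → ∣ e ∣ ≡ r → ξ * (nV G ^ℚ (q ∸ r)) ≤ ℕ→ℚ (extCount G q r e)))

FullComplex : {N : ℕ} → ℚ → ℚ → ℕ → ℕ → Cx N → Set
FullComplex ε ξ q r G =
  Σ ℚ (λ d → (ξ ≤ d) × Regular ε d q r G)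
  × Dense ξ (q ℕ.+ r) r G
  × Extendable ξ q r G

EpsComplex : {N : ℕ} → ℚ → ℚ → ℕ → ℕ → Cx N → Set
EpsComplex {N} ε ξ q r G =
  Σ (Subset N → Bool) (λ Y → IsGraphOn q Y (V G) × FullComplex ε ξ q r (restrict G q Y))

open import Data.List.Relation.Unary.All using (All)
open import Data.List.Relation.Unary.Unique.Propositional using (Unique)

Supercomplex : {N : ℕ} → ℚ → ℚ → ℕ → ℕ → Cx N → Set
Supercomplex {N} ε ξ q r G = ∀ (i : ℕ) → i ℕ.≤ r →
  (F : List (Subset N)) → Unique F → All (λ f → Edge G f × (∣ f ∣ ≡ i)) F →
  1 ℕ.≤ length F → length F ℕ.≤ 2 ^ i →
  EpsComplex ε ξ (q ∸ i) (r ∸ i) (⨅ (map (link G) F))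

{-# OPTIONS --safe #-}

-- Deleting the edges of G that contain an edge of H loses, for an r-edge e, only the sets Q
-- such that Q ∪ e contains an edge h of H meeting Q.  Such a Q is pinned down by h ∩ e
-- (2 ^ r choices), by all vertices of h ─ e but one together with the rest of Q (n ^ (q − r − 1)
-- choices), and by the last vertex of h, for which the codegree bound leaves Δ(H) ≤ γ n choices.
-- So at most 2 ^ r γ n ^ (q − r) extensions are lost, which moves regularity, density and
-- extendability by 2 ^ r γ; for extendability h lies in an r-subset g ≠ e of Q ∪ e and hence
-- again meets Q.  For supercomplexes the same count runs in the common link of at most 2 ^ i
-- edges f of size i, with f ∪ e in place of e; as n ≥ r 2 ^ (r + 1) this link keeps at least
-- n / 2 vertices, which gives the constant 2 ^ i · 2 ^ r · 2 ≤ 2 ^ (2 r + 1).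
module Submission where

open import Defs
open import Data.Bool using (Bool; true; false; _∧_; _∨_; not; if_then_else_)
open import Data.Bool.ListAction using (all; any)
open import Data.Bool.Properties using (T-≡; ∨-identityʳ)
open import Data.Empty using (⊥-elim)
open import Data.Fin using (zero; suc)
open import Data.Fin.Subset
  using (Subset; inside; outside; _∈_; _∉_; _⊆_; _⊈_; _∪_; _∩_; _─_; ⁅_⁆; ∣_∣)
  renaming (⊥ to ∅)
open import Data.Fin.Subset.Properties using (_⊆?_; ⊆-antisym; p─q⊆p; x∈p∪q⁻; ∪-identityˡ)
open import Data.List using (List; []; _∷_; _++_; map; length; foldr)
open import Data.List.Membership.Propositional using (find; lose) renaming (_∈_ to _∈ₗ_)
open import Data.List.Membership.Propositional.Properties using (∈-map⁺; ∈-++⁺ˡ; ∈-++⁺ʳ)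
open import Data.List.Relation.Unary.Any using (here; there)
open import Data.List.Relation.Unary.Any.Properties using (any⁺; any⁻)
open import Data.List.Relation.Unary.All using (lookup)
open import Data.List.Relation.Unary.All.Properties using (all⁺)
open import Data.Nat using (ℕ; zero; suc; _∸_; _^_)
open import Data.Nat as ℕ using ()
open import Data.Rational using (ℚ; 0ℚ)
open import Data.Rational as ℚ using ()
open import Data.Product using (∃; _×_; _,_; proj₁; proj₂)
open import Data.Sum using (_⊎_; inj₁; inj₂; [_,_]′)
open import Data.Vec using ([]; _∷_; here; there)
open import Function using (_∘_; id; case_of_; Equivalence)
open import Relation.Nullary using (Dec; yes; no)
open import Relation.Nullary.Decidable using (⌊_⌋; _×-dec_)
open import Relation.Binary.PropositionalEquality
  using (_≡_; _≢_; refl; sym; trans; cong; cong₂; subst)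

module T-≡ {b} = Equivalence (T-≡ {b})

∧-true⁺ : ∀ {a b} → a ≡ true → b ≡ true → a ∧ b ≡ true
∧-true⁺ refl refl = refl

∧-true⁻ : ∀ a {b} → a ∧ b ≡ true → a ≡ true × b ≡ true
∧-true⁻ true b≡true = refl , b≡true

∧-not-true⁻ : ∀ a {b} → a ∧ not b ≡ true → a ≡ true × b ≡ false
∧-not-true⁻ true {false} _ = refl , refl

∧-true-false : ∀ {a b} → a ≡ true → a ∧ b ≡ false → b ≡ false
∧-true-false refl b≡false = b≡false

∧-false-true : ∀ a {b} → a ∧ b ≡ false → b ≡ true → a ≡ false
∧-false-true false _       _      = refl
∧-false-true true  b≡false b≡true with () ← trans (sym b≡false) b≡true

∧-monoˡ-true : ∀ {a a′ b} → (a ≡ true → a′ ≡ true) → a ∧ b ≡ true → a′ ∧ b ≡ true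
∧-monoˡ-true {true} a⇒a′ b = ∧-true⁺ (a⇒a′ refl) b

∧-monoʳ-true : ∀ a {b b′} → (b ≡ true → b′ ≡ true) → a ∧ b ≡ true → a ∧ b′ ≡ true
∧-monoʳ-true true b⇒b′ b = b⇒b′ b

∨-monoʳ-true : ∀ a {b b′} → (b ≡ true → b′ ≡ true) → a ∨ b ≡ true → a ∨ b′ ≡ true
∨-monoʳ-true true  _    _ = refl
∨-monoʳ-true false b⇒b′ b = b⇒b′ b

∨-false⁻ : ∀ a {b} → a ∨ b ≡ false → a ≡ false × b ≡ false
∨-false⁻ false b≡false = refl , b≡false

not-false⁻ : ∀ {a} → not a ≡ false → a ≡ true
not-false⁻ {true} _ = refl

all-true⁻ : ∀ {A : Set} (p : A → Bool) {xs x} → all p xs ≡ true → x ∈ₗ xs → p x ≡ true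
all-true⁻ p {xs} allp x∈xs = T-≡.to (lookup (all⁺ p xs (T-≡.from allp)) x∈xs)

all-false⁻ : ∀ {A : Set} (p : A → Bool) xs → all p xs ≡ false → ∃ λ x → x ∈ₗ xs × p x ≡ false
all-false⁻ p (x ∷ xs) allp with p x in px
... | false = x , here refl , px
... | true  = let y , y∈xs , py = all-false⁻ p xs allp in y , there y∈xs , py

all-mono : ∀ {A : Set} {p p′ : A → Bool} (xs : List A) →
  (∀ x → p x ≡ true → p′ x ≡ true) → all p xs ≡ true → all p′ xs ≡ true
all-mono []       _    _    = refl
all-mono {p = p} (x ∷ xs) p⇒p′ allp =
  let px , allp-xs = ∧-true⁻ (p x) allp in ∧-true⁺ (p⇒p′ x px) (all-mono xs p⇒p′ allp-xs)

isYes-true⁻ : ∀ {P : Set} (P? : Dec P) → ⌊ P? ⌋ ≡ true → P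
isYes-true⁻ (yes p) _ = p

isYes-true⁺ : ∀ {P : Set} (P? : Dec P) → P → ⌊ P? ⌋ ≡ true
isYes-true⁺ (yes _) _ = refl
isYes-true⁺ (no ¬p) p = ⊥-elim (¬p p)

⊆ᵇ⁻ : ∀ {N} {e f : Subset N} → e ⊆ᵇ f ≡ true → e ⊆ f
⊆ᵇ⁻ {e = e} {f} = isYes-true⁻ (e ⊆? f)

⊆ᵇ⁺ : ∀ {N} {e f : Subset N} → e ⊆ f → e ⊆ᵇ f ≡ true
⊆ᵇ⁺ {e = e} {f} = isYes-true⁺ (e ⊆? f)

⊈ᵇ⁻ : ∀ {N} {e f : Subset N} → not (e ⊆ᵇ f) ≡ true → e ⊈ f
⊈ᵇ⁻ e⊈ᵇf e⊆f with () ← trans (sym e⊈ᵇf) (cong not (⊆ᵇ⁺ e⊆f))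

⊈ᵇ⁺ : ∀ {N} {e f : Subset N} → e ⊈ f → not (e ⊆ᵇ f) ≡ true
⊈ᵇ⁺ {e = e} {f} e⊈f with e ⊆? f
... | yes e⊆f = ⊥-elim (e⊈f e⊆f)
... | no  _   = refl

=ᵇ-refl : ∀ {N} (e : Subset N) → e =ᵇ e ≡ true
=ᵇ-refl e = ∧-true⁺ (⊆ᵇ⁺ {e = e} λ x∈e → x∈e) (⊆ᵇ⁺ {e = e} λ x∈e → x∈e)

size=ᵇ⁻ : ∀ {N} (e : Subset N) {k} → size=ᵇ e k ≡ true → ∣ e ∣ ≡ k
size=ᵇ⁻ e {k} = isYes-true⁻ (∣ e ∣ ℕ.≟ k)

size=ᵇ⁺ : ∀ {N} (e : Subset N) {k} → ∣ e ∣ ≡ k → size=ᵇ e k ≡ true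
size=ᵇ⁺ e {k} = isYes-true⁺ (∣ e ∣ ℕ.≟ k)

allSubsets-complete : ∀ N (Q : Subset N) → Q ∈ₗ allSubsets N
allSubsets-complete zero    []            = here refl
allSubsets-complete (suc N) (outside ∷ Q) = ∈-++⁺ˡ (∈-map⁺ (outside ∷_) (allSubsets-complete N Q))
allSubsets-complete (suc N) (inside ∷ Q)  =
  ∈-++⁺ʳ (map (outside ∷_) (allSubsets N)) (∈-map⁺ (inside ∷_) (allSubsets-complete N Q))

module _ {N : ℕ} (p : Subset N → Bool) where

  any-allSubsets⁺ : ∀ Q → p Q ≡ true → any p (allSubsets N) ≡ true
  any-allSubsets⁺ Q pQ = T-≡.to (any⁺ p (lose (allSubsets-complete N Q) (T-≡.from pQ)))

  any-allSubsets⁻ : any p (allSubsets N) ≡ true → ∃ λ Q → p Q ≡ true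
  any-allSubsets⁻ anyp = let Q , _ , pQ = find (any⁻ p (allSubsets N) (T-≡.from anyp)) in Q , T-≡.to pQ

  all-allSubsets⁻ : all p (allSubsets N) ≡ true → ∀ Q → p Q ≡ true
  all-allSubsets⁻ allp Q = all-true⁻ p allp (allSubsets-complete N Q)

module Counting where

  open import Data.Nat using (_+_; _*_; _≤_; z≤n; s≤s)
  open import Data.Nat.Properties
  open import Data.Fin.Subset.Properties using (drop-∷-⊆; ∣⊥∣≡0; ⊥⊆)
  open ≤-Reasoning

  -- count P of Defs is countIn (allSubsets N) P
  countIn : ∀ {A : Set} → List A → (A → Bool) → ℕ
  countIn xs P = foldr (λ x acc → if P x then suc acc else acc) 0 xs

  countIn-none : ∀ {A : Set} (xs : List A) {P : A → Bool} → (∀ x → P x ≢ true) → countIn xs P ≡ 0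
  countIn-none [] _ = refl
  countIn-none (x ∷ xs) {P} P-empty with P x in Px
  ... | true with () ← P-empty x Px
  ... | false = countIn-none xs P-empty

  countIn-mono : ∀ {A : Set} (xs : List A) {P P′ : A → Bool} →
    (∀ x → P x ≡ true → P′ x ≡ true) → countIn xs P ≤ countIn xs P′
  countIn-mono [] _ = z≤n
  countIn-mono (x ∷ xs) {P} {P′} P⊆P′ with P x | P′ x | P⊆P′ x
  ... | true  | true  | _ = s≤s (countIn-mono xs P⊆P′)
  ... | true  | false | Px⇒P′x with () ← Px⇒P′x refl
  ... | false | true  | _ = m≤n⇒m≤1+n (countIn-mono xs P⊆P′)
  ... | false | false | _ = countIn-mono xs P⊆P′

  countIn-≤-+-∖ : ∀ {A : Set} (xs : List A) (P P′ : A → Bool) →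
    countIn xs P ≤ countIn xs P′ + countIn xs (λ x → P x ∧ not (P′ x))
  countIn-≤-+-∖ [] P P′ = z≤n
  countIn-≤-+-∖ (x ∷ xs) P P′ with P x | P′ x | countIn-≤-+-∖ xs P P′
  ... | true  | true  | ih = s≤s ih
  ... | true  | false | ih = ≤-trans (s≤s ih) (≤-reflexive (sym (+-suc _ _)))
  ... | false | true  | ih = m≤n⇒m≤1+n ih
  ... | false | false | ih = ih

  countIn-cover : ∀ {A B : Set} (xs : List A) (ys : List B) {P : B → Bool} {I : A → Bool}
    {K : A → B → Bool} {M : ℕ} →
    (∀ y → P y ≡ true → ∃ λ x → x ∈ₗ xs × I x ≡ true × K x y ≡ true) →
    (∀ x → x ∈ₗ xs → I x ≡ true → countIn ys (K x) ≤ M) →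
    countIn ys P ≤ countIn xs I * M
  countIn-cover [] ys {P} cover _ = ≤-reflexive (countIn-none ys uncovered)
    where
    uncovered : ∀ y → P y ≢ true
    uncovered y Py with cover y Py
    ... | _ , () , _
  countIn-cover (x ∷ xs) ys {P} {I} {K} {M} cover bound with I x in Ix
  ... | false = countIn-cover xs ys cover-xs (λ x′ → bound x′ ∘ there)
    where
    cover-xs : ∀ y → P y ≡ true → ∃ λ x′ → x′ ∈ₗ xs × I x′ ≡ true × K x′ y ≡ true
    cover-xs y Py with cover y Py
    ... | _ , here refl , Ix′ , _ with () ← trans (sym Ix′) Ix
    ... | x′ , there x′∈xs , w = x′ , x′∈xs , w
  ... | true = begin
    countIn ys P                                              ≤⟨ countIn-≤-+-∖ ys P (K x) ⟩
    countIn ys (K x) + countIn ys (λ y → P y ∧ not (K x y))  ≤⟨ +-mono-≤ (bound x (here refl) Ix) rest ⟩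
    M + countIn xs I * M                                      ∎
    where
    cover-xs : ∀ y → P y ∧ not (K x y) ≡ true → ∃ λ x′ → x′ ∈ₗ xs × I x′ ≡ true × K x′ y ≡ true
    cover-xs y Py∖Kxy with ∧-not-true⁻ (P y) Py∖Kxy
    ... | Py , ¬Kxy with cover y Py
    ...   | _ , here refl , _ , Kxy with () ← trans (sym Kxy) ¬Kxy
    ...   | x′ , there x′∈xs , w = x′ , x′∈xs , w
    rest = countIn-cover xs ys cover-xs (λ x′ → bound x′ ∘ there)

  countIn-const-true : ∀ {A : Set} (xs : List A) → countIn xs (λ _ → true) ≡ length xs
  countIn-const-true [] = refl
  countIn-const-true (x ∷ xs) = cong suc (countIn-const-true xs)

  countIn-++ : ∀ {A : Set} (xs ys : List A) P → countIn (xs ++ ys) P ≡ countIn xs P + countIn ys P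
  countIn-++ [] ys P = refl
  countIn-++ (x ∷ xs) ys P with P x
  ... | true  = cong suc (countIn-++ xs ys P)
  ... | false = countIn-++ xs ys P

  countIn-map : ∀ {A B : Set} (g : A → B) xs P → countIn (map g xs) P ≡ countIn xs (P ∘ g)
  countIn-map g [] P = refl
  countIn-map g (x ∷ xs) P with P (g x)
  ... | true  = cong suc (countIn-map g xs P)
  ... | false = countIn-map g xs P

  count-cover : ∀ {N} {P I : Subset N → Bool} {K : Subset N → Subset N → Bool} {M : ℕ} →
    (∀ Q → P Q ≡ true → ∃ λ x → I x ≡ true × K x Q ≡ true) →
    (∀ x → I x ≡ true → count (K x) ≤ M) →
    count P ≤ count I * M
  count-cover {N} cover bound = countIn-cover (allSubsets N) (allSubsets N) coverₗ (λ x _ → bound x)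
    where
    coverₗ = λ Q PQ → let x , Ix , KxQ = cover Q PQ in x , allSubsets-complete N x , Ix , KxQ

  count-cover-list : ∀ {N} (F : List (Subset N)) {P : Subset N → Bool}
    {K : Subset N → Subset N → Bool} {M : ℕ} →
    (∀ Q → P Q ≡ true → ∃ λ x → x ∈ₗ F × K x Q ≡ true) →
    (∀ x → x ∈ₗ F → count (K x) ≤ M) →
    count P ≤ length F * M
  count-cover-list {N} F {P} {M = M} cover bound =
    subst (λ c → count P ≤ c * M) (countIn-const-true F)
      (countIn-cover F (allSubsets N) coverₗ (λ x x∈F _ → bound x x∈F))
    where
    coverₗ = λ Q PQ → let x , x∈F , KxQ = cover Q PQ in x , x∈F , refl , KxQ

  count-suc : ∀ {N} (P : Subset (suc N) → Bool) →
    count P ≡ count (P ∘ (outside ∷_)) + count (P ∘ (inside ∷_))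
  count-suc {N} P = trans (countIn-++ (map (outside ∷_) (allSubsets N)) _ P)
    (cong₂ _+_ (countIn-map (outside ∷_) (allSubsets N) P) (countIn-map (inside ∷_) (allSubsets N) P))

  count-suc-≤ : ∀ {N} {P : Subset (suc N) → Bool} {a b} →
    count (P ∘ (outside ∷_)) ≤ a → count (P ∘ (inside ∷_)) ≤ b → count P ≤ a + b
  count-suc-≤ {P = P} out≤a in≤b = ≤-trans (≤-reflexive (count-suc P)) (+-mono-≤ out≤a in≤b)

  count-empty : ∀ {N} {P : Subset N → Bool} {b} → (∀ Q → P Q ≢ true) → count P ≤ b
  count-empty {N} P-empty = ≤-trans (≤-reflexive (countIn-none (allSubsets N) P-empty)) z≤n

  zero∉outside : ∀ {N} {p : Subset N} → zero ∉ outside ∷ p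
  zero∉outside ()

  count-subsets-≤ : ∀ {N} (B : Subset N) {P : Subset N → Bool} →
    (∀ T → P T ≡ true → T ⊆ B) → count P ≤ 2 ^ ∣ B ∣
  count-subsets-≤ [] {P} _ with P []
  ... | true  = ≤-refl
  ... | false = z≤n
  count-subsets-≤ (outside ∷ B) {P} P⊆B = ≤-trans
    (count-suc-≤ {P = P} (count-subsets-≤ B (λ T → drop-∷-⊆ ∘ P⊆B _))
                 (count-empty {P = P ∘ (inside ∷_)} (λ T PT → zero∉outside (P⊆B _ PT here))))
    (≤-reflexive (+-identityʳ _))
  count-subsets-≤ (inside ∷ B) {P} P⊆B = ≤-trans
    (count-suc-≤ {P = P} (count-subsets-≤ B (λ T → drop-∷-⊆ ∘ P⊆B _)) (count-subsets-≤ B (λ T → drop-∷-⊆ ∘ P⊆B _)))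
    (≤-reflexive (cong (2 ^ ∣ B ∣ +_) (sym (+-identityʳ _))))

  -- m ^ (t ∸ a) if a ≤ t, and 0 otherwise: no t-set contains an a-set with a > t.
  supersetBound : ℕ → ℕ → ℕ → ℕ
  supersetBound m zero    t       = m ^ t
  supersetBound m (suc a) zero    = 0
  supersetBound m (suc a) (suc t) = supersetBound m a t

  supersetBound-mono : ∀ m a t → supersetBound m a t ≤ supersetBound (suc m) a t
  supersetBound-mono m zero    t       = ^-monoˡ-≤ t (n≤1+n m)
  supersetBound-mono m (suc a) zero    = z≤n
  supersetBound-mono m (suc a) (suc t) = supersetBound-mono m a t

  supersetBound-pascal : ∀ m a t →
    supersetBound m a (suc t) + supersetBound m a t ≤ supersetBound (suc m) a (suc t)
  supersetBound-pascal m zero t = begin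
    m * m ^ t + m ^ t             ≡⟨ +-comm (m * m ^ t) (m ^ t) ⟩
    m ^ t + m * m ^ t             ≤⟨ +-mono-≤ (^-monoˡ-≤ t (n≤1+n m)) (*-monoʳ-≤ m (^-monoˡ-≤ t (n≤1+n m))) ⟩
    suc m ^ t + m * suc m ^ t     ∎
  supersetBound-pascal m (suc a) zero    = ≤-trans (≤-reflexive (+-identityʳ _)) (supersetBound-mono m a 0)
  supersetBound-pascal m (suc a) (suc t) = supersetBound-pascal m a t

  ^*supersetBound≤ : ∀ m a t → m ^ a * supersetBound m a t ≤ m ^ t
  ^*supersetBound≤ m zero    t       = ≤-reflexive (*-identityˡ (m ^ t))
  ^*supersetBound≤ m (suc a) zero    = ≤-trans (≤-reflexive (*-zeroʳ (m ^ suc a))) z≤n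
  ^*supersetBound≤ m (suc a) (suc t) = begin
    m * m ^ a * supersetBound m a t     ≡⟨ *-assoc m (m ^ a) _ ⟩
    m * (m ^ a * supersetBound m a t)   ≤⟨ *-monoʳ-≤ m (^*supersetBound≤ m a t) ⟩
    m * m ^ t                           ∎

  private
    module _ {N} {V A : Subset N} {v a t} {P : Subset (suc N) → Bool}
             (P⊆ : ∀ Q → P Q ≡ true → Q ⊆ v ∷ V × ∣ Q ∣ ≡ t × a ∷ A ⊆ Q) where

      outside-tail : ∀ Q → P (outside ∷ Q) ≡ true → Q ⊆ V × ∣ Q ∣ ≡ t × A ⊆ Q
      outside-tail Q PQ = let Q⊆V , ∣Q∣≡t , A⊆Q = P⊆ _ PQ in drop-∷-⊆ Q⊆V , ∣Q∣≡t , drop-∷-⊆ A⊆Q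

      inside-tail : ∀ {t′} → t ≡ suc t′ → ∀ Q → P (inside ∷ Q) ≡ true → Q ⊆ V × ∣ Q ∣ ≡ t′ × A ⊆ Q
      inside-tail refl Q PQ = let Q⊆V , ∣Q∣≡t , A⊆Q = P⊆ _ PQ in drop-∷-⊆ Q⊆V , suc-injective ∣Q∣≡t , drop-∷-⊆ A⊆Q

      no-inside-outside-V : v ≡ outside → ∀ Q → P (inside ∷ Q) ≢ true
      no-inside-outside-V refl Q PQ = zero∉outside (proj₁ (P⊆ _ PQ) here)

      no-inside-empty : t ≡ 0 → ∀ Q → P (inside ∷ Q) ≢ true
      no-inside-empty refl Q PQ with () ← proj₁ (proj₂ (P⊆ _ PQ))

      no-outside-inside-A : a ≡ inside → ∀ Q → P (outside ∷ Q) ≢ true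
      no-outside-inside-A refl Q PQ = zero∉outside (proj₂ (proj₂ (P⊆ _ PQ)) here)

  ^*supersetBound-suc≤ : ∀ m k t → m ^ k * supersetBound m (suc k) t ≤ m ^ (t ∸ 1)
  ^*supersetBound-suc≤ m k zero    = ≤-trans (≤-reflexive (*-zeroʳ (m ^ k))) z≤n
  ^*supersetBound-suc≤ m k (suc t) = ^*supersetBound≤ m k t

  count-supersets-≤ : ∀ {N} (V A : Subset N) t {P : Subset N → Bool} →
    (∀ Q → P Q ≡ true → Q ⊆ V × ∣ Q ∣ ≡ t × A ⊆ Q) →
    count P ≤ supersetBound ∣ V ∣ ∣ A ∣ t
  count-supersets-≤ [] [] t {P} P⊆ with P [] in P[]
  ... | false = z≤n
  ... | true with P⊆ [] P[]
  ...   | _ , refl , _ = ≤-refl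
  count-supersets-≤ (outside ∷ V) (outside ∷ A) t {P} P⊆ = ≤-trans
    (count-suc-≤ {P = P} (count-supersets-≤ V A t (outside-tail P⊆))
                         (count-empty {P = P ∘ (inside ∷_)} (no-inside-outside-V P⊆ refl)))
    (≤-reflexive (+-identityʳ _))
  count-supersets-≤ (outside ∷ V) (inside ∷ A) t {P} P⊆ = ≤-trans
    (count-suc-≤ {P = P} {0} {0} (count-empty {P = P ∘ (outside ∷_)} (no-outside-inside-A P⊆ refl))
                                 (count-empty {P = P ∘ (inside ∷_)} (no-inside-outside-V P⊆ refl)))
    z≤n
  count-supersets-≤ (inside ∷ V) (inside ∷ A) zero {P} P⊆ =
    count-suc-≤ {P = P} {0} {0} (count-empty {P = P ∘ (outside ∷_)} (no-outside-inside-A P⊆ refl))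
                                (count-empty {P = P ∘ (inside ∷_)} (no-inside-empty P⊆ refl))
  count-supersets-≤ (inside ∷ V) (inside ∷ A) (suc t) {P} P⊆ =
    count-suc-≤ {P = P} (count-empty {P = P ∘ (outside ∷_)} (no-outside-inside-A P⊆ refl))
                        (≤-trans (count-supersets-≤ V A t (inside-tail P⊆ refl))
                                 (supersetBound-mono ∣ V ∣ ∣ A ∣ t))
  count-supersets-≤ (inside ∷ V) (outside ∷ A) zero {P} P⊆ = ≤-trans
    (count-suc-≤ {P = P} (count-supersets-≤ V A 0 (outside-tail P⊆))
                         (count-empty {P = P ∘ (inside ∷_)} (no-inside-empty P⊆ refl)))
    (≤-trans (≤-reflexive (+-identityʳ _)) (supersetBound-mono ∣ V ∣ ∣ A ∣ 0))
  count-supersets-≤ (inside ∷ V) (outside ∷ A) (suc t) {P} P⊆ = ≤-trans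
    (count-suc-≤ {P = P} (count-supersets-≤ V A (suc t) (outside-tail P⊆))
                         (count-supersets-≤ V A t (inside-tail P⊆ refl)))
    (supersetBound-pascal ∣ V ∣ ∣ A ∣ t)

  count-ksubsets-≤ : ∀ {N} (V : Subset N) k {P : Subset N → Bool} →
    (∀ Q → P Q ≡ true → Q ⊆ V × ∣ Q ∣ ≡ k) → count P ≤ ∣ V ∣ ^ k
  count-ksubsets-≤ {N} V k {P} P⊆ = subst (λ a → count P ≤ supersetBound ∣ V ∣ a k) (∣⊥∣≡0 N)
    (count-supersets-≤ V ∅ k (λ Q PQ → let Q⊆V , ∣Q∣≡k = P⊆ Q PQ in Q⊆V , ∣Q∣≡k , ⊥⊆))

module SubsetProperties where

  open import Data.Nat using (_+_; _≤_; z≤n; s≤s)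
  open import Data.Nat.Properties
  open import Data.Fin.Subset using (_-_)
  open import Data.Fin.Subset.Properties
    using (drop-there; drop-∷-⊆; out⊆; s⊆s; p⊆q⇒∣p∣≤∣q∣; p─⊥≡p; ∪-identityʳ; p∩q⊆p; p∩q⊆q; x∈p∩q⁺)
  open ≤-Reasoning

  x∈p─q⁻ : ∀ {n} (p q : Subset n) {x} → x ∈ p ─ q → x ∈ p × x ∉ q
  x∈p─q⁻ (inside  ∷ p) (outside ∷ q) here = here , λ ()
  x∈p─q⁻ (inside  ∷ p) (inside  ∷ q) {zero} ()
  x∈p─q⁻ (outside ∷ p) (inside  ∷ q) {zero} ()
  x∈p─q⁻ (outside ∷ p) (outside ∷ q) {zero} ()
  x∈p─q⁻ (_ ∷ p) (_ ∷ q) (there x∈p─q) =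
    let x∈p , x∉q = x∈p─q⁻ p q x∈p─q in there x∈p , x∉q ∘ drop-there

  ⊈⇒∃∉ : ∀ {n} {p q : Subset n} → p ⊈ q → ∃ λ x → x ∈ p × x ∉ q
  ⊈⇒∃∉ {p = []} {[]} p⊈q = ⊥-elim (p⊈q λ ())
  ⊈⇒∃∉ {p = inside ∷ p} {outside ∷ q} _ = zero , here , λ ()
  ⊈⇒∃∉ {p = inside ∷ p} {inside ∷ q} p⊈q =
    let x , x∈p , x∉q = ⊈⇒∃∉ (p⊈q ∘ s⊆s) in suc x , there x∈p , x∉q ∘ drop-there
  ⊈⇒∃∉ {p = outside ∷ p} {_ ∷ q} p⊈q =
    let x , x∈p , x∉q = ⊈⇒∃∉ (p⊈q ∘ out⊆) in suc x , there x∈p , x∉q ∘ drop-there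

  ∣p∣≡∣p∩q∣+∣p─q∣ : ∀ {n} (p q : Subset n) → ∣ p ∣ ≡ ∣ p ∩ q ∣ + ∣ p ─ q ∣
  ∣p∣≡∣p∩q∣+∣p─q∣ []            []            = refl
  ∣p∣≡∣p∩q∣+∣p─q∣ (inside  ∷ p) (inside  ∷ q) = cong suc (∣p∣≡∣p∩q∣+∣p─q∣ p q)
  ∣p∣≡∣p∩q∣+∣p─q∣ (inside  ∷ p) (outside ∷ q) = trans (cong suc (∣p∣≡∣p∩q∣+∣p─q∣ p q)) (sym (+-suc _ _))
  ∣p∣≡∣p∩q∣+∣p─q∣ (outside ∷ p) (inside  ∷ q) = ∣p∣≡∣p∩q∣+∣p─q∣ p q
  ∣p∣≡∣p∩q∣+∣p─q∣ (outside ∷ p) (outside ∷ q) = ∣p∣≡∣p∩q∣+∣p─q∣ p q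

  ∣p∪q∣≤∣p∣+∣q∣ : ∀ {n} (p q : Subset n) → ∣ p ∪ q ∣ ≤ ∣ p ∣ + ∣ q ∣
  ∣p∪q∣≤∣p∣+∣q∣ []            []            = z≤n
  ∣p∪q∣≤∣p∣+∣q∣ (inside  ∷ p) (inside  ∷ q) = s≤s (≤-trans (∣p∪q∣≤∣p∣+∣q∣ p q) (+-monoʳ-≤ ∣ p ∣ (n≤1+n _)))
  ∣p∪q∣≤∣p∣+∣q∣ (inside  ∷ p) (outside ∷ q) = s≤s (∣p∪q∣≤∣p∣+∣q∣ p q)
  ∣p∪q∣≤∣p∣+∣q∣ (outside ∷ p) (inside  ∷ q) = ≤-trans (s≤s (∣p∪q∣≤∣p∣+∣q∣ p q)) (≤-reflexive (sym (+-suc _ _)))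
  ∣p∪q∣≤∣p∣+∣q∣ (outside ∷ p) (outside ∷ q) = ∣p∪q∣≤∣p∣+∣q∣ p q

  ∣p∪q∣≡∣p∣+∣q∣ : ∀ {n} (p q : Subset n) → (∀ {x} → x ∈ p → x ∉ q) → ∣ p ∪ q ∣ ≡ ∣ p ∣ + ∣ q ∣
  ∣p∪q∣≡∣p∣+∣q∣ []            []            _    = refl
  ∣p∪q∣≡∣p∣+∣q∣ (inside  ∷ p) (inside  ∷ q) disj = ⊥-elim (disj here here)
  ∣p∪q∣≡∣p∣+∣q∣ (inside  ∷ p) (outside ∷ q) disj =
    cong suc (∣p∪q∣≡∣p∣+∣q∣ p q (λ x∈p x∈q → disj (there x∈p) (there x∈q)))
  ∣p∪q∣≡∣p∣+∣q∣ (outside ∷ p) (inside  ∷ q) disj =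
    trans (cong suc (∣p∪q∣≡∣p∣+∣q∣ p q (λ x∈p x∈q → disj (there x∈p) (there x∈q)))) (sym (+-suc _ _))
  ∣p∪q∣≡∣p∣+∣q∣ (outside ∷ p) (outside ∷ q) disj = ∣p∪q∣≡∣p∣+∣q∣ p q (λ x∈p x∈q → disj (there x∈p) (there x∈q))

  ∣p∣≡1+∣p-x∣ : ∀ {n} (p : Subset n) {x} → x ∈ p → ∣ p ∣ ≡ suc ∣ p - x ∣
  ∣p∣≡1+∣p-x∣ (inside ∷ p) here        = cong (suc ∘ ∣_∣) (sym (p─⊥≡p p))
  ∣p∣≡1+∣p-x∣ (inside ∷ p) (there x∈p) = cong suc (∣p∣≡1+∣p-x∣ p x∈p)
  ∣p∣≡1+∣p-x∣ (outside ∷ p) (there x∈p) = ∣p∣≡1+∣p-x∣ p x∈p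

  p⊆q∧∣q∣≤∣p∣⇒q⊆p : ∀ {n} {p q : Subset n} → p ⊆ q → ∣ q ∣ ≤ ∣ p ∣ → q ⊆ p
  p⊆q∧∣q∣≤∣p∣⇒q⊆p {p = []} {[]} _ _ ()
  p⊆q∧∣q∣≤∣p∣⇒q⊆p {p = outside ∷ p} {outside ∷ q} p⊆q ∣q∣≤∣p∣ = out⊆ (p⊆q∧∣q∣≤∣p∣⇒q⊆p (drop-∷-⊆ p⊆q) ∣q∣≤∣p∣)
  p⊆q∧∣q∣≤∣p∣⇒q⊆p {p = outside ∷ p} {inside ∷ q} p⊆q ∣q∣≤∣p∣ =
    ⊥-elim (<-irrefl refl (<-≤-trans (s≤s (p⊆q⇒∣p∣≤∣q∣ (drop-∷-⊆ p⊆q))) ∣q∣≤∣p∣))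
  p⊆q∧∣q∣≤∣p∣⇒q⊆p {p = inside ∷ p} {outside ∷ q} p⊆q _ with () ← p⊆q here
  p⊆q∧∣q∣≤∣p∣⇒q⊆p {p = inside ∷ p} {inside ∷ q} p⊆q (s≤s ∣q∣≤∣p∣) = s⊆s (p⊆q∧∣q∣≤∣p∣⇒q⊆p (drop-∷-⊆ p⊆q) ∣q∣≤∣p∣)

  -- h ─ f lies in g ∩ e and has at least s elements, so the s-sets g and e coincide
  covering-complement-unique : ∀ {n} {h f g e : Subset n} {s} → ∣ f ∣ + s ≤ ∣ h ∣ → ∣ g ∣ ≡ s → ∣ e ∣ ≡ s →
    h ⊆ f ∪ g → h ⊆ f ∪ e → g ≡ e
  covering-complement-unique {h = h} {f} {g} {e} {s} ∣f∣+s≤∣h∣ ∣g∣≡s ∣e∣≡s h⊆f∪g h⊆f∪e =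
    ⊆-antisym (p∩q⊆q g e ∘ g⊆g∩e) (p∩q⊆p g e ∘ e⊆g∩e)
    where
    h─f⊆g∩e : h ─ f ⊆ g ∩ e
    h─f⊆g∩e y∈h─f with x∈p─q⁻ h f y∈h─f
    ... | y∈h , y∉f with x∈p∪q⁻ f g (h⊆f∪g y∈h) | x∈p∪q⁻ f e (h⊆f∪e y∈h)
    ...   | inj₁ y∈f | _        = ⊥-elim (y∉f y∈f)
    ...   | inj₂ _   | inj₁ y∈f = ⊥-elim (y∉f y∈f)
    ...   | inj₂ y∈g | inj₂ y∈e = x∈p∩q⁺ (y∈g , y∈e)
    s≤∣g∩e∣ : s ≤ ∣ g ∩ e ∣
    s≤∣g∩e∣ = ≤-trans (+-cancelˡ-≤ ∣ f ∣ s _ (begin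
      ∣ f ∣ + s                 ≤⟨ ∣f∣+s≤∣h∣ ⟩
      ∣ h ∣                     ≡⟨ ∣p∣≡∣p∩q∣+∣p─q∣ h f ⟩
      ∣ h ∩ f ∣ + ∣ h ─ f ∣     ≤⟨ +-monoˡ-≤ _ (p⊆q⇒∣p∣≤∣q∣ (p∩q⊆q h f)) ⟩
      ∣ f ∣ + ∣ h ─ f ∣         ∎)) (p⊆q⇒∣p∣≤∣q∣ h─f⊆g∩e)
    g⊆g∩e : g ⊆ g ∩ e
    g⊆g∩e = p⊆q∧∣q∣≤∣p∣⇒q⊆p (p∩q⊆p g e) (subst (_≤ ∣ g ∩ e ∣) (sym ∣g∣≡s) s≤∣g∩e∣)
    e⊆g∩e : e ⊆ g ∩ e
    e⊆g∩e = p⊆q∧∣q∣≤∣p∣⇒q⊆p (p∩q⊆q g e) (subst (_≤ ∣ g ∩ e ∣) (sym ∣e∣≡s) s≤∣g∩e∣)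

  ∪-⊆ : ∀ {n} {p q r : Subset n} → p ⊆ r → q ⊆ r → p ∪ q ⊆ r
  ∪-⊆ {p = p} {q} p⊆r q⊆r x∈p∪q = [ p⊆r , q⊆r ]′ (x∈p∪q⁻ p q x∈p∪q)

  p∩q∪p─q≡p : ∀ {n} (p q : Subset n) → (p ∩ q) ∪ (p ─ q) ≡ p
  p∩q∪p─q≡p []            []            = refl
  p∩q∪p─q≡p (inside  ∷ p) (inside  ∷ q) = cong (inside ∷_) (p∩q∪p─q≡p p q)
  p∩q∪p─q≡p (inside  ∷ p) (outside ∷ q) = cong (inside ∷_) (p∩q∪p─q≡p p q)
  p∩q∪p─q≡p (outside ∷ p) (inside  ∷ q) = cong (outside ∷_) (p∩q∪p─q≡p p q)
  p∩q∪p─q≡p (outside ∷ p) (outside ∷ q) = cong (outside ∷_) (p∩q∪p─q≡p p q)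

  p-x∪⁅x⁆≡p : ∀ {n} (p : Subset n) {x} → x ∈ p → (p - x) ∪ ⁅ x ⁆ ≡ p
  p-x∪⁅x⁆≡p (inside ∷ p) here = cong (inside ∷_) (trans (∪-identityʳ (p ─ ∅)) (p─⊥≡p p))
  p-x∪⁅x⁆≡p (s ∷ p) (there x∈p) = cong₂ _∷_ (∨-identityʳ s) (p-x∪⁅x⁆≡p p x∈p)

module RationalArithmetic where

  open import Data.Nat as ℕ using ()
  import Data.Nat.Properties as ℕ
  import Data.Nat.Coprimality as Coprimality
  open import Data.Integer as ℤ using (+_)
  import Data.Integer.Properties as ℤ
  open import Data.Rational using (ℚ; mkℚ; 0ℚ; toℚᵘ; nonNegative; _+_; _-_; _*_; -_; _≤_; *≤*)
  open import Data.Rational.Properties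
  import Data.Rational.Unnormalised as ℚᵘ
  import Data.Rational.Unnormalised.Properties as ℚᵘ
  open import Data.Rational.Solver using (module +-*-Solver)
  open +-*-Solver
  open import Relation.Binary.PropositionalEquality using (subst₂)
  open import Algebra.Properties.CommutativeSemigroup ℕ.*-commutativeSemigroup using (x∙yz≈y∙xz)
  open ≤-Reasoning

  ℕ→ℚ≡mkℚ : ∀ n → ℕ→ℚ n ≡ mkℚ (+ n) 0 (Coprimality.sym (Coprimality.1-coprimeTo n))
  ℕ→ℚ≡mkℚ n = normalize-coprime (Coprimality.sym (Coprimality.1-coprimeTo n))

  ℕ→ℚ-+ : ∀ m n → ℕ→ℚ (m ℕ.+ n) ≡ ℕ→ℚ m + ℕ→ℚ n
  ℕ→ℚ-+ m n = toℚᵘ-injective (ℚᵘ.≃-trans homo (ℚᵘ.≃-sym (toℚᵘ-homo-+ (ℕ→ℚ m) (ℕ→ℚ n))))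
    where
    homo : toℚᵘ (ℕ→ℚ (m ℕ.+ n)) ℚᵘ.≃ toℚᵘ (ℕ→ℚ m) ℚᵘ.+ toℚᵘ (ℕ→ℚ n)
    homo rewrite ℕ→ℚ≡mkℚ (m ℕ.+ n) | ℕ→ℚ≡mkℚ m | ℕ→ℚ≡mkℚ n = ℚᵘ.*≡* (cong (ℤ._* + 1)
      (trans (ℤ.pos-+ m n) (sym (cong₂ ℤ._+_ (ℤ.*-identityʳ (+ m)) (ℤ.*-identityʳ (+ n))))))

  ℕ→ℚ-* : ∀ m n → ℕ→ℚ (m ℕ.* n) ≡ ℕ→ℚ m * ℕ→ℚ n
  ℕ→ℚ-* m n = toℚᵘ-injective (ℚᵘ.≃-trans homo (ℚᵘ.≃-sym (toℚᵘ-homo-* (ℕ→ℚ m) (ℕ→ℚ n))))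
    where
    homo : toℚᵘ (ℕ→ℚ (m ℕ.* n)) ℚᵘ.≃ toℚᵘ (ℕ→ℚ m) ℚᵘ.* toℚᵘ (ℕ→ℚ n)
    homo rewrite ℕ→ℚ≡mkℚ (m ℕ.* n) | ℕ→ℚ≡mkℚ m | ℕ→ℚ≡mkℚ n = ℚᵘ.*≡* (cong (ℤ._* + 1) (ℤ.pos-* m n))

  ℕ→ℚ-mono-≤ : ∀ {m n} → m ℕ.≤ n → ℕ→ℚ m ≤ ℕ→ℚ n
  ℕ→ℚ-mono-≤ {m} {n} m≤n rewrite ℕ→ℚ≡mkℚ m | ℕ→ℚ≡mkℚ n =
    *≤* (subst₂ ℤ._≤_ (sym (ℤ.*-identityʳ (+ m))) (sym (ℤ.*-identityʳ (+ n))) (ℤ.+≤+ m≤n))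

  ℕ→ℚ-nonNeg : ∀ n → 0ℚ ≤ ℕ→ℚ n
  ℕ→ℚ-nonNeg n = ℕ→ℚ-mono-≤ {0} {n} ℕ.z≤n

  *-nonNeg : ∀ {p q} → 0ℚ ≤ p → 0ℚ ≤ q → 0ℚ ≤ p * q
  *-nonNeg {p} {q} 0≤p 0≤q =
    nonNegative⁻¹ (p * q) {{nonNeg*nonNeg⇒nonNeg p {{nonNegative 0≤p}} q {{nonNegative 0≤q}}}}

  common-ℕ-bound : ∀ {A : Set} {P : A → Set} → (∀ x → Dec (P x)) → (c : A → ℕ) {q : ℚ} → 0ℚ ≤ q →
    (∀ x → P x → ℕ→ℚ (c x) ≤ q) → (xs : List A) →
    ∃ λ D → (∀ x → x ∈ₗ xs → P x → c x ℕ.≤ D) × ℕ→ℚ D ≤ q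
  common-ℕ-bound P? c 0≤q c≤q [] = 0 , (λ _ ()) , 0≤q
  common-ℕ-bound {P = P} P? c {q} 0≤q c≤q (x ∷ xs) with P? x | common-ℕ-bound P? c 0≤q c≤q xs
  ... | no ¬Px | D , bound , D≤q = D , bound′ , D≤q
    where
    bound′ : ∀ y → y ∈ₗ x ∷ xs → P y → c y ℕ.≤ D
    bound′ y (here refl) Py = ⊥-elim (¬Px Py)
    bound′ y (there y∈xs) = bound y y∈xs
  ... | yes Px | D , bound , D≤q = c x ℕ.⊔ D , bound′ , ⊔≤q (ℕ.⊔-sel (c x) D)
    where
    bound′ : ∀ y → y ∈ₗ x ∷ xs → P y → c y ℕ.≤ c x ℕ.⊔ D
    bound′ y (here refl) _ = ℕ.m≤m⊔n (c x) D
    bound′ y (there y∈xs) Py = ℕ.m≤n⇒m≤o⊔n (c x) (bound y y∈xs Py)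
    ⊔≤q : c x ℕ.⊔ D ≡ c x ⊎ c x ℕ.⊔ D ≡ D → ℕ→ℚ (c x ℕ.⊔ D) ≤ q
    ⊔≤q (inj₁ ≡cx) rewrite ≡cx = c≤q x Px
    ⊔≤q (inj₂ ≡D) rewrite ≡D = D≤q

  loss-lower : ∀ a k M {u u′ : ℚ} → a * M ≤ u → u ≤ u′ + k * M → (a - k) * M ≤ u′
  loss-lower a k M {u} {u′} aM≤u u≤u′+kM = begin
    (a - k) * M           ≡⟨ solve 3 (λ a k m → (a :- k) :* m := a :* m :- k :* m) refl a k M ⟩
    a * M - k * M         ≤⟨ +-monoˡ-≤ (- (k * M)) (≤-trans aM≤u u≤u′+kM) ⟩
    u′ + k * M - k * M    ≡⟨ solve 2 (λ u c → u :+ c :- c := u) refl u′ (k * M) ⟩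
    u′                    ∎

  loss-upper : ∀ a k M {u : ℚ} → u ≤ a * M → 0ℚ ≤ k * M → u ≤ (a + k) * M
  loss-upper a k M {u} u≤aM 0≤kM = begin
    u                  ≤⟨ u≤aM ⟩
    a * M              ≡⟨ sym (+-identityʳ (a * M)) ⟩
    a * M + 0ℚ         ≤⟨ +-monoʳ-≤ (a * M) 0≤kM ⟩
    a * M + k * M      ≡⟨ solve 3 (λ a k m → a :* m :+ k :* m := (a :+ k) :* m) refl a k M ⟩
    (a + k) * M        ∎

  ℕ→ℚ-mono-≤-+ : ∀ {u u′ b : ℕ} {x : ℚ} → u ℕ.≤ u′ ℕ.+ b → ℕ→ℚ b ≤ x → ℕ→ℚ u ≤ ℕ→ℚ u′ + x
  ℕ→ℚ-mono-≤-+ {u} {u′} {b} {x} u≤u′+b b≤x = begin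
    ℕ→ℚ u               ≤⟨ ℕ→ℚ-mono-≤ u≤u′+b ⟩
    ℕ→ℚ (u′ ℕ.+ b)      ≡⟨ ℕ→ℚ-+ u′ b ⟩
    ℕ→ℚ u′ + ℕ→ℚ b      ≤⟨ +-monoʳ-≤ (ℕ→ℚ u′) b≤x ⟩
    ℕ→ℚ u′ + x          ∎

  ℕ→ℚ-scale-≤ : ∀ {γ : ℚ} (D n L P c X : ℕ) → 0ℚ ≤ γ → ℕ→ℚ D ≤ γ * ℕ→ℚ n →
    L ℕ.* (n ℕ.* P) ℕ.≤ c ℕ.* X → ℕ→ℚ (L ℕ.* (D ℕ.* P)) ≤ ℕ→ℚ c * γ * ℕ→ℚ X
  ℕ→ℚ-scale-≤ {γ} D n L P c X 0≤γ D≤γn LnP≤cX = begin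
    ℕ→ℚ (L ℕ.* (D ℕ.* P))        ≡⟨ cong ℕ→ℚ (x∙yz≈y∙xz L D P) ⟩
    ℕ→ℚ (D ℕ.* (L ℕ.* P))        ≡⟨ ℕ→ℚ-* D (L ℕ.* P) ⟩
    ℕ→ℚ D * ℕ→ℚ (L ℕ.* P)        ≤⟨ *-monoʳ-≤-nonNeg (ℕ→ℚ (L ℕ.* P)) {{nonNegative (ℕ→ℚ-nonNeg (L ℕ.* P))}} D≤γn ⟩
    γ * ℕ→ℚ n * ℕ→ℚ (L ℕ.* P)    ≡⟨ *-assoc γ (ℕ→ℚ n) _ ⟩
    γ * (ℕ→ℚ n * ℕ→ℚ (L ℕ.* P))  ≡⟨ cong (γ *_) (sym (ℕ→ℚ-* n (L ℕ.* P))) ⟩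
    γ * ℕ→ℚ (n ℕ.* (L ℕ.* P))    ≤⟨ *-monoˡ-≤-nonNeg γ {{nonNegative 0≤γ}} (ℕ→ℚ-mono-≤ {n ℕ.* (L ℕ.* P)} {c ℕ.* X}
                                      (subst (ℕ._≤ c ℕ.* X) (x∙yz≈y∙xz L n P) LnP≤cX)) ⟩
    γ * ℕ→ℚ (c ℕ.* X)            ≡⟨ cong (γ *_) (ℕ→ℚ-* c X) ⟩
    γ * (ℕ→ℚ c * ℕ→ℚ X)          ≡⟨ solve 3 (λ g c x → g :* (c :* x) := c :* g :* x) refl γ (ℕ→ℚ c) (ℕ→ℚ X) ⟩
    ℕ→ℚ c * γ * ℕ→ℚ X            ∎

  x-[y+z]≡x-y-z : ∀ x y z → x - (y + z) ≡ x - y - z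
  x-[y+z]≡x-y-z = solve 3 (λ x y z → x :- (y :+ z) := x :- y :- z) refl

  x-y≤x : ∀ x {y} → 0ℚ ≤ y → x - y ≤ x
  x-y≤x x {y} 0≤y = begin
    x - y    ≤⟨ +-monoʳ-≤ x (neg-antimono-≤ 0≤y) ⟩
    x - 0ℚ   ≡⟨ solve 1 (λ x → x :- con 0ℚ := x) refl x ⟩
    x        ∎

open Counting
open SubsetProperties
open RationalArithmetic

codegree : ∀ {N} → (Subset N → Bool) → Subset N → Subset N → ℕ
codegree H W S = count (λ f → (f ⊆ᵇ (W ─ S)) ∧ H (S ∪ f))

CodegreeBound : ∀ {N} → ℕ → (Subset N → Bool) → Subset N → ℕ → Set
CodegreeBound r′ H W D = ∀ S → S ⊆ W → ∣ S ∣ ≡ r′ ∸ 1 → codegree H W S ℕ.≤ D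

record IntegralCodegreeBound {N} (r′ : ℕ) (H : Subset N → Bool) (W : Subset N) (γ : ℚ) : Set where
  field
    D          : ℕ
    codegree≤D : CodegreeBound r′ H W D
    D≤γ∣W∣     : ℕ→ℚ D ℚ.≤ γ ℚ.* ℕ→ℚ ∣ W ∣

codegree-bound : ∀ {N} r′ H (W : Subset N) {γ} → 0ℚ ℚ.≤ γ → MaxDegLe r′ H W γ →
  IntegralCodegreeBound r′ H W γ
codegree-bound {N} r′ H W 0≤γ max-codegree
  with common-ℕ-bound (λ S → S ⊆? W ×-dec ∣ S ∣ ℕ.≟ r′ ∸ 1) (codegree H W) (*-nonNeg 0≤γ (ℕ→ℚ-nonNeg ∣ W ∣))
                 (λ S (S⊆W , ∣S∣≡) → max-codegree S S⊆W ∣S∣≡) (allSubsets N)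
... | D , bound , D≤γ∣W∣ = record
  { D          = D
  ; codegree≤D = λ S S⊆W ∣S∣≡ → bound S (allSubsets-complete N S) (S⊆W , ∣S∣≡)
  ; D≤γ∣W∣     = D≤γ∣W∣
  }

module CrossingEdges {N : ℕ} (r′ : ℕ) (H : Subset N → Bool) (W : Subset N)
                     (H-on-W : IsGraphOn r′ H W) (D : ℕ) (codegree≤D : CodegreeBound r′ H W D) where

  open import Data.Nat using (_+_; _*_; _≤_; _≤?_; _≟_; s≤s)
  open import Data.Nat.Properties
  open import Data.Fin.Subset using (_-_)
  open import Data.Fin.Subset.Properties
    using (q⊆p∪q; p∩q⊆q; ∣p∩q∣≤∣p∣; x∈p∧x∉q⇒x∈p─q; x∈⁅x⁆; x∈⁅y⁆⇒x≡y; ∣⁅x⁆∣≡1)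
  open import Algebra.Properties.CommutativeSemigroup *-commutativeSemigroup using (x∙yz≈y∙xz)
  open ≤-Reasoning

  Crossing : Subset N → Subset N → Set
  Crossing B Q = ∃ λ h → H h ≡ true × h ⊆ B ∪ Q × h ⊈ B

  crossingᵇ : Subset N → Subset N → Bool
  crossingᵇ B Q = any (λ h → H h ∧ (h ⊆ᵇ (B ∪ Q)) ∧ not (h ⊆ᵇ B)) (allSubsets N)

  crossingᵇ⁺ : ∀ {B Q} → Crossing B Q → crossingᵇ B Q ≡ true
  crossingᵇ⁺ (h , Hh , h⊆B∪Q , h⊈B) = any-allSubsets⁺ _ h (∧-true⁺ Hh (∧-true⁺ (⊆ᵇ⁺ h⊆B∪Q) (⊈ᵇ⁺ h⊈B)))

  crossingᵇ⁻ : ∀ {B Q} → crossingᵇ B Q ≡ true → Crossing B Q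
  crossingᵇ⁻ crosses with any-allSubsets⁻ _ crosses
  ... | h , h-crosses with ∧-true⁻ (H h) h-crosses
  ...   | Hh , rest with ∧-true⁻ (h ⊆ᵇ _) rest
  ...     | h⊆B∪Q , h⊈B = h , Hh , ⊆ᵇ⁻ h⊆B∪Q , ⊈ᵇ⁻ h⊈B

  -- An H-edge h ⊆ B ∪ Q with h ⊈ B is T ∪ R ∪ ⁅ x ⁆ with T = h ∩ B, x ∈ h ─ B and R ⊆ Q.
  -- There are at most 2 ^ ∣ B ∣ choices for T, ∣ U ∣ ^ ∣ R ∣ for R, D for x given T ∪ R, and
  -- ∣ U ∣ ^ (t ∸ 1 ∸ ∣ R ∣) for Q ⊇ R ∪ ⁅ x ⁆: at most 2 ^ ∣ B ∣ · D · ∣ U ∣ ^ (t ∸ 1) sets Q.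
  module _ {B U : Subset N} (t : ℕ) (B⊆W : B ⊆ W) (U⊆W : U ⊆ W) (U∩B≡∅ : ∀ {x} → x ∈ U → x ∉ B) where

    m : ℕ
    m = ∣ U ∣

    rest : Subset N → ℕ
    rest T = r′ ∸ 1 ∸ ∣ T ∣

    Trace : Subset N → Set
    Trace T = T ⊆ B × suc ∣ T ∣ ≤ r′

    Body : Subset N → Subset N → Set
    Body T R = R ⊆ U × ∣ R ∣ ≡ rest T

    Apex : Subset N → Subset N → Set
    Apex S f = f ⊆ W ─ S × H (S ∪ f) ≡ true × ∣ f ∣ ≡ 1

    Completion : Subset N → Subset N → Subset N → Set
    Completion R f Q = Q ⊆ U × ∣ Q ∣ ≡ t × R ∪ f ⊆ Q

    trace? : ∀ T → Dec (Trace T)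
    trace? T = T ⊆? B ×-dec suc ∣ T ∣ ≤? r′

    body? : ∀ T R → Dec (Body T R)
    body? T R = R ⊆? U ×-dec ∣ R ∣ ≟ rest T

    apex? : ∀ S f → Dec (Apex S f)
    apex? S f = f ⊆? W ─ S ×-dec H (S ∪ f) Data.Bool.≟ true ×-dec ∣ f ∣ ≟ 1

    completion? : ∀ R f Q → Dec (Completion R f Q)
    completion? R f Q = Q ⊆? U ×-dec ∣ Q ∣ ≟ t ×-dec R ∪ f ⊆? Q

    apex-completion : Subset N → Subset N → Subset N → Bool
    apex-completion T R Q = any (λ f → ⌊ apex? (T ∪ R) f ⌋ ∧ ⌊ completion? R f Q ⌋) (allSubsets N)

    crossing-with-trace : Subset N → Subset N → Bool
    crossing-with-trace T Q = any (λ R → ⌊ body? T R ⌋ ∧ apex-completion T R Q) (allSubsets N)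

    count-completion : ∀ {T R f} → Body T R → Apex (T ∪ R) f →
      count (⌊_⌋ ∘ completion? R f) ≤ supersetBound m (suc (rest T)) t
    count-completion {T} {R} {f} (R⊆U , ∣R∣≡) (f⊆W─T∪R , _ , ∣f∣≡1) =
      subst (λ a → count (⌊_⌋ ∘ completion? R f) ≤ supersetBound m a t) ∣R∪f∣≡
        (count-supersets-≤ U (R ∪ f) t (λ Q → isYes-true⁻ (completion? R f Q)))
      where
      R∩f≡∅ : ∀ {x} → x ∈ R → x ∉ f
      R∩f≡∅ x∈R x∈f = proj₂ (x∈p─q⁻ W (T ∪ R) (f⊆W─T∪R x∈f)) (q⊆p∪q T R x∈R)
      ∣R∪f∣≡ : ∣ R ∪ f ∣ ≡ suc (rest T)
      ∣R∪f∣≡ = trans (∣p∪q∣≡∣p∣+∣q∣ R f R∩f≡∅) (trans (cong₂ _+_ ∣R∣≡ ∣f∣≡1) (+-comm (rest T) 1))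

    count-apex-completion : ∀ {T R} → Trace T → Body T R →
      count (apex-completion T R) ≤ D * supersetBound m (suc (rest T)) t
    count-apex-completion {T} {R} (T⊆B , suc∣T∣≤r′) body@(R⊆U , ∣R∣≡) = begin
      count (apex-completion T R)
        ≤⟨ count-cover cover (λ f apex → count-completion body (isYes-true⁻ (apex? (T ∪ R) f) apex)) ⟩
      count (⌊_⌋ ∘ apex? (T ∪ R)) * supersetBound m (suc (rest T)) t
        ≤⟨ *-monoˡ-≤ _ (≤-trans (countIn-mono (allSubsets N) apex⇒codegree) (codegree≤D (T ∪ R) T∪R⊆W ∣T∪R∣≡)) ⟩
      D * supersetBound m (suc (rest T)) t ∎
      where
      cover : ∀ Q → apex-completion T R Q ≡ true →
              ∃ λ f → ⌊ apex? (T ∪ R) f ⌋ ≡ true × ⌊ completion? R f Q ⌋ ≡ true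
      cover Q covered = let f , f-covers = any-allSubsets⁻ _ covered in f , ∧-true⁻ _ f-covers
      apex⇒codegree : ∀ f → ⌊ apex? (T ∪ R) f ⌋ ≡ true → (f ⊆ᵇ (W ─ (T ∪ R))) ∧ H ((T ∪ R) ∪ f) ≡ true
      apex⇒codegree f apex = let f⊆ , Hf , _ = isYes-true⁻ (apex? (T ∪ R) f) apex in ∧-true⁺ (⊆ᵇ⁺ f⊆) Hf
      T∪R⊆W : T ∪ R ⊆ W
      T∪R⊆W = ∪-⊆ (B⊆W ∘ T⊆B) (U⊆W ∘ R⊆U)
      ∣T∪R∣≡ : ∣ T ∪ R ∣ ≡ r′ ∸ 1
      ∣T∪R∣≡ = begin-equality
        ∣ T ∪ R ∣           ≡⟨ ∣p∪q∣≡∣p∣+∣q∣ T R (λ x∈T x∈R → U∩B≡∅ (R⊆U x∈R) (T⊆B x∈T)) ⟩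
        ∣ T ∣ + ∣ R ∣       ≡⟨ cong (∣ T ∣ +_) ∣R∣≡ ⟩
        ∣ T ∣ + rest T      ≡⟨ m+[n∸m]≡n (∸-monoˡ-≤ 1 suc∣T∣≤r′) ⟩
        r′ ∸ 1              ∎

    count-crossing-with-trace : ∀ {T} → Trace T → count (crossing-with-trace T) ≤ D * m ^ (t ∸ 1)
    count-crossing-with-trace {T} trace = begin
      count (crossing-with-trace T)
        ≤⟨ count-cover cover (λ R body → count-apex-completion trace (isYes-true⁻ (body? T R) body)) ⟩
      count (⌊_⌋ ∘ body? T) * (D * supersetBound m (suc k) t)
        ≤⟨ *-monoˡ-≤ _ (count-ksubsets-≤ U k (λ R → isYes-true⁻ (body? T R))) ⟩
      m ^ k * (D * supersetBound m (suc k) t)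
        ≡⟨ x∙yz≈y∙xz (m ^ k) D _ ⟩
      D * (m ^ k * supersetBound m (suc k) t)
        ≤⟨ *-monoʳ-≤ D (^*supersetBound-suc≤ m k t) ⟩
      D * m ^ (t ∸ 1) ∎
      where
      k = rest T
      cover : ∀ Q → crossing-with-trace T Q ≡ true → ∃ λ R → ⌊ body? T R ⌋ ≡ true × apex-completion T R Q ≡ true
      cover Q covered = let R , R-covers = any-allSubsets⁻ _ covered in R , ∧-true⁻ _ R-covers

    module _ {Q h x} (Q⊆U : Q ⊆ U) (Hh : H h ≡ true) (h⊆B∪Q : h ⊆ B ∪ Q) (x∈h : x ∈ h) (x∉B : x ∉ B) where

      private
        S T R : Subset N
        S = h - x
        T = S ∩ B
        R = S ─ B

        h⊆W : h ⊆ W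
        h⊆W = proj₁ (H-on-W h Hh)

        r′≡1+∣S∣ : r′ ≡ suc ∣ S ∣
        r′≡1+∣S∣ = trans (sym (proj₂ (H-on-W h Hh))) (∣p∣≡1+∣p-x∣ h x∈h)

        h─B⊆Q : ∀ {y} → y ∈ h → y ∉ B → y ∈ Q
        h─B⊆Q y∈h y∉B = [ ⊥-elim ∘ y∉B , id ]′ (x∈p∪q⁻ B Q (h⊆B∪Q y∈h))

        R⊆Q : R ⊆ Q
        R⊆Q y∈R = let y∈S , y∉B = x∈p─q⁻ S B y∈R in h─B⊆Q (p─q⊆p h ⁅ x ⁆ y∈S) y∉B

        x∉S : x ∉ S
        x∉S x∈S = proj₂ (x∈p─q⁻ h ⁅ x ⁆ x∈S) (x∈⁅x⁆ x)

      edge-trace : Trace T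
      edge-trace = p∩q⊆q S B , subst (suc ∣ T ∣ ≤_) (sym r′≡1+∣S∣) (s≤s (∣p∩q∣≤∣p∣ S B))

      edge-body : Body T R
      edge-body = Q⊆U ∘ R⊆Q , (begin-equality
        ∣ R ∣                   ≡⟨ sym (m+n∸m≡n ∣ T ∣ ∣ R ∣) ⟩
        ∣ T ∣ + ∣ R ∣ ∸ ∣ T ∣   ≡⟨ cong (_∸ ∣ T ∣) (sym (∣p∣≡∣p∩q∣+∣p─q∣ S B)) ⟩
        ∣ S ∣ ∸ ∣ T ∣           ≡⟨ cong (λ n → n ∸ 1 ∸ ∣ T ∣) (sym r′≡1+∣S∣) ⟩
        rest T                  ∎)

      edge-apex : Apex (T ∪ R) ⁅ x ⁆
      edge-apex = subst (λ S′ → Apex S′ ⁅ x ⁆) (sym (p∩q∪p─q≡p S B))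
        ( (λ y∈⁅x⁆ → subst (_∈ W ─ S) (sym (x∈⁅y⁆⇒x≡y x y∈⁅x⁆)) (x∈p∧x∉q⇒x∈p─q (h⊆W x∈h) x∉S))
        , trans (cong H (p-x∪⁅x⁆≡p h x∈h)) Hh
        , ∣⁅x⁆∣≡1 x )

      edge-completion : R ∪ ⁅ x ⁆ ⊆ Q
      edge-completion = ∪-⊆ R⊆Q (λ y∈⁅x⁆ → subst (_∈ Q) (sym (x∈⁅y⁆⇒x≡y x y∈⁅x⁆)) (h─B⊆Q x∈h x∉B))

      crossing-has-trace : ∣ Q ∣ ≡ t → ∃ λ T′ → ⌊ trace? T′ ⌋ ≡ true × crossing-with-trace T′ Q ≡ true
      crossing-has-trace ∣Q∣≡t = T , isYes-true⁺ (trace? T) edge-trace ,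
        any-allSubsets⁺ (λ R′ → ⌊ body? T R′ ⌋ ∧ apex-completion T R′ Q) R
          (∧-true⁺ (isYes-true⁺ (body? T R) edge-body)
            (any-allSubsets⁺ (λ f → ⌊ apex? (T ∪ R) f ⌋ ∧ ⌊ completion? R f Q ⌋) ⁅ x ⁆
              (∧-true⁺ (isYes-true⁺ (apex? (T ∪ R) ⁅ x ⁆) edge-apex)
                       (isYes-true⁺ (completion? R ⁅ x ⁆ Q) (Q⊆U , ∣Q∣≡t , edge-completion)))))

    count-crossing : ∀ {P : Subset N → Bool} → (∀ Q → P Q ≡ true → Q ⊆ U × ∣ Q ∣ ≡ t × Crossing B Q) →
      count P ≤ 2 ^ ∣ B ∣ * (D * m ^ (t ∸ 1))
    count-crossing {P} P-crossing = begin
      count P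
        ≤⟨ count-cover cover (λ T trace → count-crossing-with-trace (isYes-true⁻ (trace? T) trace)) ⟩
      count (⌊_⌋ ∘ trace?) * (D * m ^ (t ∸ 1))
        ≤⟨ *-monoˡ-≤ _ (count-subsets-≤ B (λ T → proj₁ ∘ isYes-true⁻ (trace? T))) ⟩
      2 ^ ∣ B ∣ * (D * m ^ (t ∸ 1)) ∎
      where
      cover : ∀ Q → P Q ≡ true → ∃ λ T → ⌊ trace? T ⌋ ≡ true × crossing-with-trace T Q ≡ true
      cover Q PQ with P-crossing Q PQ
      ... | Q⊆U , ∣Q∣≡t , h , Hh , h⊆B∪Q , h⊈B with ⊈⇒∃∉ h⊈B
      ...   | x , x∈h , x∉B = crossing-has-trace Q⊆U Hh h⊆B∪Q x∈h x∉B ∣Q∣≡t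

record _⊑_ {N} (G′ G : Cx N) : Set where
  field
    V-≡   : V G′ ≡ V G
    mem-⊆ : ∀ x → mem G′ x ≡ true → mem G x ≡ true

  nV-≡ : nV G′ ≡ nV G
  nV-≡ = cong ∣_∣ V-≡

  Edge-⊑ : ∀ {e} → Edge G′ e → Edge G e
  Edge-⊑ (e∈G′ , e⊆V) = mem-⊆ _ e∈G′ , subst (_ ⊆_) V-≡ e⊆V

  upDeg-⊑ : ∀ t e → upDeg G′ t e ℕ.≤ upDeg G t e
  upDeg-⊑ t e rewrite V-≡ = countIn-mono (allSubsets N) λ f →
    ∧-monoʳ-true (f ⊆ᵇ (V G ─ e)) (∧-monoʳ-true (size=ᵇ f t) (mem-⊆ (e ∪ f)))

  extCount-⊑ : ∀ q r e → extCount G′ q r e ℕ.≤ extCount G q r e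
  extCount-⊑ q r e rewrite V-≡ = countIn-mono (allSubsets N) λ Q →
    ∧-monoʳ-true (Q ⊆ᵇ (V G ─ e)) (∧-monoʳ-true (size=ᵇ Q (q ∸ r)) (all-mono (allSubsets N) λ g →
      ∨-monoʳ-true _ (∧-monoˡ-true (mem-⊆ g))))

module Stability {N} {G′ G : Cx N} (G′⊑G : G′ ⊑ G) (k : ℚ) (0≤k : 0ℚ ℚ.≤ k) (r : ℕ) where

  open import Data.Nat using (_<_)
  open import Data.Nat.Properties using (m<n⇒0<n∸m; ≤-trans; m≤m+n)
  open import Data.Rational using (_+_; _-_; _*_; _≤_)
  import Data.Rational.Properties as ℚ
  open _⊑_ G′⊑G

  DegreeLoss : Set
  DegreeLoss = ∀ e → Edge G′ e → ∣ e ∣ ≡ r → ∀ t → 1 ℕ.≤ t →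
    ℕ→ℚ (upDeg G t e) ≤ ℕ→ℚ (upDeg G′ t e) + k * nV G ^ℚ t

  ExtensionLoss : ℕ → Set
  ExtensionLoss q = ∀ e → e ⊆ V G → ∣ e ∣ ≡ r →
    ℕ→ℚ (extCount G q r e) ≤ ℕ→ℚ (extCount G′ q r e) + k * nV G ^ℚ (q ∸ r)

  regular-stable : ∀ {ε d q} → r < q → DegreeLoss → Regular ε d q r G → Regular (ε + k) d q r G′
  regular-stable {ε} {d} {q} r<q loss reg e e∈G′ ∣e∣≡r =
    subst (λ n → (d - (ε + k)) * n ^ℚ t ≤ ℕ→ℚ (upDeg G′ t e)) (sym nV-≡) lower ,
    subst (λ n → ℕ→ℚ (upDeg G′ t e) ≤ (d + (ε + k)) * n ^ℚ t) (sym nV-≡) upper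
    where
    t = q ∸ r
    M = nV G ^ℚ t
    lower : (d - (ε + k)) * M ≤ ℕ→ℚ (upDeg G′ t e)
    lower = subst (λ a → a * M ≤ ℕ→ℚ (upDeg G′ t e)) (sym (x-[y+z]≡x-y-z d ε k))
      (loss-lower (d - ε) k M (proj₁ (reg e (Edge-⊑ e∈G′) ∣e∣≡r)) (loss e e∈G′ ∣e∣≡r t (m<n⇒0<n∸m r<q)))
    upper : ℕ→ℚ (upDeg G′ t e) ≤ (d + (ε + k)) * M
    upper = subst (λ a → ℕ→ℚ (upDeg G′ t e) ≤ a * M) (ℚ.+-assoc d ε k)
      (loss-upper (d + ε) k M (ℚ.≤-trans (ℕ→ℚ-mono-≤ (upDeg-⊑ t e)) (proj₂ (reg e (Edge-⊑ e∈G′) ∣e∣≡r)))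
                  (*-nonNeg 0≤k (ℕ→ℚ-nonNeg (nV G ^ t))))

  dense-stable : ∀ {ξ q} → r < q → DegreeLoss → Dense ξ q r G → Dense (ξ - k) q r G′
  dense-stable {ξ} {q} r<q loss dense e e∈G′ ∣e∣≡r =
    subst (λ n → (ξ - k) * n ^ℚ t ≤ ℕ→ℚ (upDeg G′ t e)) (sym nV-≡)
      (loss-lower ξ k (nV G ^ℚ t) (dense e (Edge-⊑ e∈G′) ∣e∣≡r) (loss e e∈G′ ∣e∣≡r t (m<n⇒0<n∸m r<q)))
    where
    t = q ∸ r

  extendable-stable : ∀ {ξ q} → ExtensionLoss q → Extendable ξ q r G → Extendable (ξ - k) q r G′
  extendable-stable loss (inj₁ no-r-edges) = inj₁ (λ e e∈G′ → no-r-edges e (Edge-⊑ e∈G′))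
  extendable-stable {ξ} {q} loss (inj₂ (X , X⊆V , ξn≤∣X∣ , X-extendable)) =
    inj₂ (X , subst (X ⊆_) (sym V-≡) X⊆V ,
          subst (λ n → (ξ - k) * ℕ→ℚ n ≤ ℕ→ℚ ∣ X ∣) (sym nV-≡)
            (ℚ.≤-trans (ℚ.*-monoʳ-≤-nonNeg (ℕ→ℚ (nV G)) {{ℚ.nonNegative (ℕ→ℚ-nonNeg (nV G))}} (x-y≤x ξ 0≤k))
                       ξn≤∣X∣) ,
          λ e e⊆X ∣e∣≡r → subst (λ n → (ξ - k) * n ^ℚ (q ∸ r) ≤ ℕ→ℚ (extCount G′ q r e)) (sym nV-≡)
            (loss-lower ξ k (nV G ^ℚ (q ∸ r)) (X-extendable e e⊆X ∣e∣≡r) (loss e (X⊆V ∘ e⊆X) ∣e∣≡r)))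

  full-stable : ∀ {ε ξ q} → r < q → DegreeLoss → ExtensionLoss q →
    FullComplex ε ξ q r G → FullComplex (ε + k) (ξ - k) q r G′
  full-stable {ε} {ξ} {q} r<q loss ext-loss ((d , ξ≤d , regular) , dense , extendable) =
    (d , ℚ.≤-trans (x-y≤x ξ 0≤k) ξ≤d , regular-stable {ε} {d} r<q loss regular) ,
    dense-stable {ξ} (≤-trans r<q (m≤m+n q r)) loss dense ,
    extendable-stable {ξ} ext-loss extendable

upDegᵇ : ∀ {N} → Cx N → ℕ → Subset N → Subset N → Bool
upDegᵇ G k e f = (f ⊆ᵇ (V G ─ e)) ∧ size=ᵇ f k ∧ mem G (e ∪ f)

upDegᵇ-true⁻ : ∀ {N} {G : Cx N} {k e f} → upDegᵇ G k e f ≡ true →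
  f ⊆ V G ─ e × ∣ f ∣ ≡ k × mem G (e ∪ f) ≡ true
upDegᵇ-true⁻ {G = G} {k} {e} {f} f-ext =
  let f⊆ , rest = ∧-true⁻ (f ⊆ᵇ (V G ─ e)) f-ext
      ∣f∣≡k , e∪f∈G = ∧-true⁻ (size=ᵇ f k) rest
  in ⊆ᵇ⁻ f⊆ , size=ᵇ⁻ f ∣f∣≡k , e∪f∈G

upDegᵇ-false⁻ : ∀ {N} {G : Cx N} {k e f} → f ⊆ V G ─ e → ∣ f ∣ ≡ k → upDegᵇ G k e f ≡ false →
  mem G (e ∪ f) ≡ false
upDegᵇ-false⁻ {f = f} f⊆ ∣f∣≡k = ∧-true-false (size=ᵇ⁺ f ∣f∣≡k) ∘ ∧-true-false (⊆ᵇ⁺ f⊆)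

Spanned : ∀ {N} → ℕ → Subset N → Subset N → Subset N → Set
Spanned r e Q g = g ⊆ Q ∪ e × ∣ g ∣ ≡ r × g ≢ e

spannedᵇ : ∀ {N} → ℕ → Subset N → Subset N → Subset N → Bool
spannedᵇ r e Q g = (g ⊆ᵇ (Q ∪ e)) ∧ size=ᵇ g r ∧ not (g =ᵇ e)

spannedᵇ⁺ : ∀ {N} {r} {e Q g : Subset N} → Spanned r e Q g → spannedᵇ r e Q g ≡ true
spannedᵇ⁺ {e = e} {g = g} (g⊆ , ∣g∣≡r , g≢e) = ∧-true⁺ (⊆ᵇ⁺ g⊆) (∧-true⁺ (size=ᵇ⁺ g ∣g∣≡r) not-g=e)
  where
  not-g=e : not (g =ᵇ e) ≡ true
  not-g=e with g =ᵇ e in g=e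
  ... | false = refl
  ... | true  = ⊥-elim (g≢e (let g⊆e , e⊆g = ∧-true⁻ (g ⊆ᵇ e) g=e in ⊆-antisym (⊆ᵇ⁻ g⊆e) (⊆ᵇ⁻ e⊆g)))

spannedᵇ⁻ : ∀ {N} {r} {e Q g : Subset N} → spannedᵇ r e Q g ≡ true → Spanned r e Q g
spannedᵇ⁻ {r = r} {e} {Q} {g} spanned =
  let g⊆ , rest = ∧-true⁻ (g ⊆ᵇ (Q ∪ e)) spanned
      ∣g∣≡r , not-g=e = ∧-true⁻ (size=ᵇ g r) rest
  in ⊆ᵇ⁻ g⊆ , size=ᵇ⁻ g ∣g∣≡r , λ { refl → case trans (sym not-g=e) (cong not (=ᵇ-refl g)) of λ () }

extCountᵇ : ∀ {N} → Cx N → ℕ → ℕ → Subset N → Subset N → Bool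
extCountᵇ {N} G q r e Q = (Q ⊆ᵇ (V G ─ e)) ∧ size=ᵇ Q (q ∸ r) ∧
  all (λ g → not (spannedᵇ r e Q g) ∨ (mem G g ∧ (g ⊆ᵇ V G))) (allSubsets N)

extCountᵇ-true⁻ : ∀ {N} {G : Cx N} {q r e Q} → extCountᵇ G q r e Q ≡ true →
  Q ⊆ V G ─ e × ∣ Q ∣ ≡ q ∸ r × (∀ g → Spanned r e Q g → mem G g ≡ true × g ⊆ V G)
extCountᵇ-true⁻ {G = G} {q} {r} {e} {Q} Q-ext =
  let Q⊆ , rest = ∧-true⁻ (Q ⊆ᵇ (V G ─ e)) Q-ext
      ∣Q∣≡ , all-spanned = ∧-true⁻ (size=ᵇ Q (q ∸ r)) rest
  in ⊆ᵇ⁻ Q⊆ , size=ᵇ⁻ Q ∣Q∣≡ , λ g g-spanned → edge g (all-allSubsets⁻ _ all-spanned g) (spannedᵇ⁺ g-spanned)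
  where
  edge : ∀ g → not (spannedᵇ r e Q g) ∨ (mem G g ∧ (g ⊆ᵇ V G)) ≡ true → spannedᵇ r e Q g ≡ true →
         mem G g ≡ true × g ⊆ V G
  edge g g-ok g-spanned rewrite g-spanned = let g∈G , g⊆V = ∧-true⁻ (mem G g) g-ok in g∈G , ⊆ᵇ⁻ g⊆V

extCountᵇ-false⁻ : ∀ {N} {G : Cx N} {q r e Q} → Q ⊆ V G ─ e → ∣ Q ∣ ≡ q ∸ r → extCountᵇ G q r e Q ≡ false →
  ∃ λ g → Spanned r e Q g × mem G g ∧ (g ⊆ᵇ V G) ≡ false
extCountᵇ-false⁻ {G = G} {r = r} {e} {Q} Q⊆ ∣Q∣≡ Q-not-ext
  with all-false⁻ _ (allSubsets _) (∧-true-false (size=ᵇ⁺ Q ∣Q∣≡) (∧-true-false (⊆ᵇ⁺ Q⊆) Q-not-ext))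
... | g , _ , g-bad = let not-spanned , g∉G = ∨-false⁻ (not (spannedᵇ r e Q g)) g-bad
                  in g , spannedᵇ⁻ (not-false⁻ not-spanned) , g∉G

-- G′ is G without the edges x such that f ∪ x contains an edge of H for some f ∈ F:
-- F = [ ∅ ] gives G − H, and the common links of G − H and of G at F are related in the same way.
record Deletion {N} (H : Subset N → Bool) (F : List (Subset N)) (G G′ : Cx N) : Set where
  field
    spanning      : G′ ⊑ G
    deleted-spans : ∀ x → x ⊆ V G → mem G x ≡ true → mem G′ x ≡ false →
                    ∃ λ f → f ∈ₗ F × ∃ λ h → H h ≡ true × h ⊆ f ∪ x
    kept-avoids   : ∀ x → mem G′ x ≡ true → ∀ f → f ∈ₗ F → ∀ h → H h ≡ true → h ⊈ f ∪ x

restrict-deletion : ∀ {N H F} {G G′ : Cx N} q Y → Deletion H F G G′ →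
  Deletion H F (restrict G q Y) (restrict G′ q Y)
restrict-deletion {G = G} {G′} q Y del = record
  { spanning      = record { V-≡ = V-≡ ; mem-⊆ = λ x → ∧-monoˡ-true (mem-⊆ x) }
  ; deleted-spans = λ x x⊆V x∈G[Y] x∉G′[Y] → let x∈G , x⊆Y = ∧-true⁻ (mem G x) x∈G[Y] in
                      deleted-spans x x⊆V x∈G (∧-false-true (mem G′ x) x∉G′[Y] x⊆Y)
  ; kept-avoids   = λ x x∈G′[Y] → kept-avoids x (proj₁ (∧-true⁻ (mem G′ x) x∈G′[Y]))
  }
  where
  open Deletion del
  open _⊑_ spanning

module Deletions {N : ℕ} (r′ : ℕ) (H : Subset N → Bool) (W : Subset N) (H-on-W : IsGraphOn r′ H W)
                 (γ : ℚ) (0≤γ : 0ℚ ℚ.≤ γ) (D : ℕ) (codegree≤D : CodegreeBound r′ H W D)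
                 (D≤γ∣W∣ : ℕ→ℚ D ℚ.≤ γ ℚ.* ℕ→ℚ ∣ W ∣)
                 (F : List (Subset N)) (i : ℕ) (F-sets : ∀ f → f ∈ₗ F → ∣ f ∣ ≡ i × f ⊆ W) where

  open import Data.Nat using (_+_; _*_; _≤_; _<_)
  open import Data.Nat.Properties
  open import Data.Fin.Subset.Properties using (p⊆p∪q; q⊆p∪q; ∪-assoc; p⊆q⇒∣p∣≤∣q∣)
  open import Relation.Binary.PropositionalEquality using (subst₂)
  open CrossingEdges r′ H W H-on-W D codegree≤D

  -- makes the number lossBound s t of lost t-extensions at most c γ (nV G) ^ t
  Scaling : ℕ → ℕ → Cx N → Set
  Scaling c s G = ∀ t → 1 ≤ t → length F * 2 ^ (i + s) * (∣ W ∣ * nV G ^ (t ∸ 1)) ≤ c * nV G ^ t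

  module Losses {G G′ : Cx N} (del : Deletion H F G G′) (V⊆W : V G ⊆ W)
                (F∩V≡∅ : ∀ f → f ∈ₗ F → ∀ {y} → y ∈ V G → y ∉ f) where

    open Deletion del
    open _⊑_ spanning

    lossBound : ℕ → ℕ → ℕ
    lossBound s t = length F * 2 ^ (i + s) * (D * nV G ^ (t ∸ 1))

    count-lost : ∀ {e s} t → e ⊆ V G → ∣ e ∣ ≡ s → {P : Subset N → Bool} →
      (∀ Q → P Q ≡ true → Q ⊆ V G ─ e × ∣ Q ∣ ≡ t × ∃ λ f → f ∈ₗ F × Crossing (f ∪ e) Q) →
      count P ≤ lossBound s t
    count-lost {e} {s} t e⊆V ∣e∣≡s {P} P-lost =
      ≤-trans (count-cover-list F cover bound) (≤-reflexive (sym (*-assoc (length F) _ _)))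
      where
      K : Subset N → Subset N → Bool
      K f Q = P Q ∧ crossingᵇ (f ∪ e) Q
      cover : ∀ Q → P Q ≡ true → ∃ λ f → f ∈ₗ F × K f Q ≡ true
      cover Q PQ = let _ , _ , f , f∈F , crossing = P-lost Q PQ in f , f∈F , ∧-true⁺ PQ (crossingᵇ⁺ crossing)
      bound : ∀ f → f ∈ₗ F → count (K f) ≤ 2 ^ (i + s) * (D * nV G ^ (t ∸ 1))
      bound f f∈F = ≤-trans (count-crossing t f∪e⊆W (V⊆W ∘ p─q⊆p (V G) e) V─e∩f∪e≡∅ K-crossing)
        (*-mono-≤ (^-monoʳ-≤ 2 ∣f∪e∣≤) (*-monoʳ-≤ D (^-monoˡ-≤ (t ∸ 1) (p⊆q⇒∣p∣≤∣q∣ (p─q⊆p (V G) e)))))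
        where
        ∣f∪e∣≤ : ∣ f ∪ e ∣ ≤ i + s
        ∣f∪e∣≤ = ≤-trans (∣p∪q∣≤∣p∣+∣q∣ f e) (≤-reflexive (cong₂ _+_ (proj₁ (F-sets f f∈F)) ∣e∣≡s))
        f∪e⊆W : f ∪ e ⊆ W
        f∪e⊆W = ∪-⊆ (proj₂ (F-sets f f∈F)) (V⊆W ∘ e⊆V)
        V─e∩f∪e≡∅ : ∀ {y} → y ∈ V G ─ e → y ∉ f ∪ e
        V─e∩f∪e≡∅ y∈V─e y∈f∪e =
          let y∈V , y∉e = x∈p─q⁻ (V G) e y∈V─e in [ F∩V≡∅ f f∈F y∈V , y∉e ]′ (x∈p∪q⁻ f e y∈f∪e)
        K-crossing : ∀ Q → K f Q ≡ true → Q ⊆ V G ─ e × ∣ Q ∣ ≡ t × Crossing (f ∪ e) Q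
        K-crossing Q KfQ = let PQ , crosses = ∧-true⁻ (P Q) KfQ
                               Q⊆ , ∣Q∣≡t , _ = P-lost Q PQ
                           in Q⊆ , ∣Q∣≡t , crossingᵇ⁻ crosses

    upDeg-loss : ∀ {e s} → e ⊆ V G → ∣ e ∣ ≡ s → (∀ f → f ∈ₗ F → ∀ h → H h ≡ true → h ⊈ f ∪ e) →
      ∀ t → upDeg G t e ≤ upDeg G′ t e + lossBound s t
    upDeg-loss {e} e⊆V ∣e∣≡s e-avoids t =
      ≤-trans (countIn-≤-+-∖ (allSubsets N) (upDegᵇ G t e) (upDegᵇ G′ t e))
              (+-monoʳ-≤ (upDeg G′ t e) (count-lost t e⊆V ∣e∣≡s lost-crosses))
      where
      lost-crosses : ∀ Q → upDegᵇ G t e Q ∧ not (upDegᵇ G′ t e Q) ≡ true →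
        Q ⊆ V G ─ e × ∣ Q ∣ ≡ t × ∃ λ f → f ∈ₗ F × Crossing (f ∪ e) Q
      lost-crosses Q lost with ∧-not-true⁻ (upDegᵇ G t e Q) lost
      ... | inG , notInG′ with upDegᵇ-true⁻ {G = G} inG
      ... | Q⊆V─e , ∣Q∣≡t , e∪Q∈G
        with deleted-spans (e ∪ Q) (∪-⊆ e⊆V (p─q⊆p (V G) e ∘ Q⊆V─e)) e∪Q∈G
               (upDegᵇ-false⁻ {G = G′} (subst (λ V′ → Q ⊆ V′ ─ e) (sym V-≡) Q⊆V─e) ∣Q∣≡t notInG′)
      ... | f , f∈F , h , Hh , h⊆f∪e∪Q =
        Q⊆V─e , ∣Q∣≡t , f , f∈F , h , Hh , subst (h ⊆_) (sym (∪-assoc f e Q)) h⊆f∪e∪Q , e-avoids f f∈F h Hh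

    -- Unlike upDeg, extCount does not require e to be an edge: an H-edge inside f ∪ e would force
    -- the spoiled r-set g to equal e.
    extCount-loss : ∀ {e s} q → e ⊆ V G → ∣ e ∣ ≡ s → i + s ≤ r′ →
      extCount G q s e ≤ extCount G′ q s e + lossBound s (q ∸ s)
    extCount-loss {e} {s} q e⊆V ∣e∣≡s i+s≤r′ =
      ≤-trans (countIn-≤-+-∖ (allSubsets N) (extCountᵇ G q s e) (extCountᵇ G′ q s e))
              (+-monoʳ-≤ (extCount G′ q s e) (count-lost (q ∸ s) e⊆V ∣e∣≡s lost-crosses))
      where
      lost-crosses : ∀ Q → extCountᵇ G q s e Q ∧ not (extCountᵇ G′ q s e Q) ≡ true →
        Q ⊆ V G ─ e × ∣ Q ∣ ≡ q ∸ s × ∃ λ f → f ∈ₗ F × Crossing (f ∪ e) Q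
      lost-crosses Q lost with ∧-not-true⁻ (extCountᵇ G q s e Q) lost
      ... | inG , notInG′ with extCountᵇ-true⁻ {G = G} inG
      ... | Q⊆V─e , ∣Q∣≡ , spanned⇒edge
        with extCountᵇ-false⁻ {G = G′} (subst (λ V′ → Q ⊆ V′ ─ e) (sym V-≡) Q⊆V─e) ∣Q∣≡ notInG′
      ... | g , g-spanned@(g⊆Q∪e , ∣g∣≡s , g≢e) , g∉G′ with spanned⇒edge g g-spanned
      ... | g∈G , g⊆V
        with deleted-spans g g⊆V g∈G (∧-false-true (mem G′ g) g∉G′ (⊆ᵇ⁺ (subst (g ⊆_) (sym V-≡) g⊆V)))
      ... | f , f∈F , h , Hh , h⊆f∪g = Q⊆V─e , ∣Q∣≡ , f , f∈F , h , Hh , h⊆f∪e∪Q , h⊈f∪e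
        where
        h⊆f∪e∪Q : h ⊆ (f ∪ e) ∪ Q
        h⊆f∪e∪Q = ∪-⊆ (p⊆p∪q Q ∘ p⊆p∪q e)
          (λ y∈g → [ q⊆p∪q (f ∪ e) Q , p⊆p∪q Q ∘ q⊆p∪q f e ]′ (x∈p∪q⁻ Q e (g⊆Q∪e y∈g))) ∘ h⊆f∪g
        h⊈f∪e : h ⊈ f ∪ e
        h⊈f∪e h⊆f∪e = g≢e (covering-complement-unique ∣f∣+s≤∣h∣ ∣g∣≡s ∣e∣≡s h⊆f∪g h⊆f∪e)
          where
          ∣f∣+s≤∣h∣ = subst₂ _≤_ (cong (_+ s) (sym (proj₁ (F-sets f f∈F)))) (sym (proj₂ (H-on-W h Hh))) i+s≤r′

    module Bounds (c s : ℕ) (scaling : Scaling c s G) where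

      k : ℚ
      k = ℕ→ℚ c ℚ.* γ

      0≤k : 0ℚ ℚ.≤ k
      0≤k = *-nonNeg (ℕ→ℚ-nonNeg c) 0≤γ

      open Stability spanning k 0≤k s

      lossBound≤ : ∀ t → 1 ≤ t → ℕ→ℚ (lossBound s t) ℚ.≤ k ℚ.* nV G ^ℚ t
      lossBound≤ t 1≤t =
        ℕ→ℚ-scale-≤ D ∣ W ∣ (length F * 2 ^ (i + s)) (nV G ^ (t ∸ 1)) c (nV G ^ t) 0≤γ D≤γ∣W∣ (scaling t 1≤t)

      degreeLoss : DegreeLoss
      degreeLoss e e∈G′ ∣e∣≡s t 1≤t =
        ℕ→ℚ-mono-≤-+ {u′ = upDeg G′ t e} {lossBound s t}
          (upDeg-loss (proj₂ (Edge-⊑ e∈G′)) ∣e∣≡s (kept-avoids e (proj₁ e∈G′)) t) (lossBound≤ t 1≤t)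

      extensionLoss : i + s ≤ r′ → ∀ {q} → s < q → ExtensionLoss q
      extensionLoss i+s≤r′ {q} s<q e e⊆V ∣e∣≡s =
        ℕ→ℚ-mono-≤-+ {u′ = extCount G′ q s e} {lossBound s (q ∸ s)}
          (extCount-loss q e⊆V ∣e∣≡s i+s≤r′) (lossBound≤ (q ∸ s) (m<n⇒0<n∸m s<q))

      regular-deletion : ∀ {ε d q} → s < q → Regular ε d q s G → Regular (ε ℚ.+ k) d q s G′
      regular-deletion {ε} {d} s<q = regular-stable {ε} {d} s<q degreeLoss

      dense-deletion : ∀ {ξ q} → s < q → Dense ξ q s G → Dense (ξ ℚ.- k) q s G′
      dense-deletion {ξ} s<q = dense-stable {ξ} s<q degreeLoss

      extendable-deletion : ∀ {ξ q} → s < q → i + s ≤ r′ → Extendable ξ q s G → Extendable (ξ ℚ.- k) q s G′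
      extendable-deletion {ξ} s<q i+s≤r′ = extendable-stable {ξ} (extensionLoss i+s≤r′ s<q)

      full-deletion : ∀ {ε ξ q} → s < q → i + s ≤ r′ →
        FullComplex ε ξ q s G → FullComplex (ε ℚ.+ k) (ξ ℚ.- k) q s G′
      full-deletion s<q i+s≤r′ = full-stable s<q degreeLoss (extensionLoss i+s≤r′ s<q)

  epsComplex-deletion : ∀ {G G′ : Cx N} → Deletion H F G G′ → V G ⊆ W →
    (∀ f → f ∈ₗ F → ∀ {y} → y ∈ V G → y ∉ f) → ∀ c s → Scaling c s G → ∀ {ε ξ q} → s < q → i + s ≤ r′ →
    EpsComplex ε ξ q s G → EpsComplex (ε ℚ.+ ℕ→ℚ c ℚ.* γ) (ξ ℚ.- ℕ→ℚ c ℚ.* γ) q s G′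
  epsComplex-deletion del V⊆W F∩V≡∅ c s scaling {q = q} s<q i+s≤r′ (Y , Y-on-V , full) =
    Y , subst (IsGraphOn q Y) (sym (_⊑_.V-≡ (Deletion.spanning del))) Y-on-V ,
    Losses.Bounds.full-deletion (restrict-deletion q Y del) V⊆W F∩V≡∅ c s scaling s<q i+s≤r′ full

minus-mem⁻ : ∀ {N} {G : Cx N} {H x} → mem (G minus H) x ≡ true → mem G x ≡ true
minus-mem⁻ {G = G} {x = x} = proj₁ ∘ ∧-true⁻ (mem G x)

minus-avoids : ∀ {N} {G : Cx N} {H x h} → mem (G minus H) x ≡ true → H h ≡ true → h ⊈ x
minus-avoids {G = G} {H} {x} {h} x∈G−H Hh h⊆x with () ←
  trans (sym (proj₂ (∧-true⁻ (mem G x) x∈G−H)))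
        (cong not (any-allSubsets⁺ (λ f → (f ⊆ᵇ x) ∧ H f) h (∧-true⁺ (⊆ᵇ⁺ h⊆x) Hh)))

minus-deleted : ∀ {N} {G : Cx N} {H x} → mem G x ≡ true → mem (G minus H) x ≡ false →
  ∃ λ h → H h ≡ true × h ⊆ x
minus-deleted {H = H} {x} x∈G x∉G−H =
  let h , h-in-x = any-allSubsets⁻ (λ f → (f ⊆ᵇ x) ∧ H f) (not-false⁻ (∧-true-false x∈G x∉G−H))
      h⊆x , Hh = ∧-true⁻ (h ⊆ᵇ x) h-in-x
  in h , Hh , ⊆ᵇ⁻ h⊆x

minus-deletion : ∀ {N} (G : Cx N) H → Deletion H (∅ ∷ []) G (G minus H)
minus-deletion G H = record
  { spanning      = record { V-≡ = refl ; mem-⊆ = λ _ → minus-mem⁻ {G = G} }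
  ; deleted-spans = λ x _ x∈G x∉G−H → let h , Hh , h⊆x = minus-deleted {G = G} x∈G x∉G−H in
                      ∅ , here refl , h , Hh , subst (h ⊆_) (sym (∪-identityˡ x)) h⊆x
  ; kept-avoids   = λ { x x∈G−H _ (here refl) h Hh → minus-avoids {G = G} x∈G−H Hh ∘ subst (h ⊆_) (∪-identityˡ x) }
  }

commonLink : ∀ {N} → Cx N → List (Subset N) → Cx N
commonLink G F = ⨅ (map (link G) F)

module CommonLinks {N : ℕ} (G : Cx N) where

  open import Data.Nat using (_+_; _*_; _≤_)
  open import Data.Nat.Properties
  open import Data.Fin.Subset using (⋃)
  open import Data.Fin.Subset.Properties
    using (_∈?_; p∩q⊆p; p∩q⊆q; x∈p∩q⁺; p⊆q⇒∣p∣≤∣q∣; ∣⊥∣≡0; p⊆p∪q; q⊆p∪q; x∈p∧x∉q⇒x∈p─q)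

  commonLink-mem⁻ : ∀ f fs {x} → mem (commonLink G (f ∷ fs)) x ≡ true →
    ∀ g → g ∈ₗ f ∷ fs → mem G (g ∪ x) ≡ true
  commonLink-mem⁻ f []        {x} x∈ _ (here refl) = proj₁ (∧-true⁻ (mem G (f ∪ x)) x∈)
  commonLink-mem⁻ f (_ ∷ _)   {x} x∈ _ (here refl) =
    proj₁ (∧-true⁻ (mem G (f ∪ x)) (proj₁ (∧-true⁻ (mem (link G f) x) x∈)))
  commonLink-mem⁻ f (f′ ∷ fs) {x} x∈ g (there g∈) =
    commonLink-mem⁻ f′ fs (proj₁ (∧-true⁻ _ (proj₂ (∧-true⁻ (mem (link G f) x) x∈)))) g g∈

  commonLink-mem⊆V : ∀ f fs {x} → mem (commonLink G (f ∷ fs)) x ≡ true → x ⊆ V (commonLink G (f ∷ fs))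
  commonLink-mem⊆V f []        {x} x∈ = ⊆ᵇ⁻ (proj₂ (∧-true⁻ (mem G (f ∪ x)) x∈))
  commonLink-mem⊆V f (f′ ∷ fs) {x} x∈ =
    ⊆ᵇ⁻ (proj₂ (∧-true⁻ (mem (commonLink G (f′ ∷ fs)) x) (proj₂ (∧-true⁻ (mem (link G f) x) x∈))))

  commonLink-mem⁺ : ∀ f fs {x} → x ⊆ V (commonLink G (f ∷ fs)) →
    (∀ g → g ∈ₗ f ∷ fs → mem G (g ∪ x) ≡ true) → mem (commonLink G (f ∷ fs)) x ≡ true
  commonLink-mem⁺ f []        x⊆V x∈links = ∧-true⁺ (x∈links f (here refl)) (⊆ᵇ⁺ x⊆V)
  commonLink-mem⁺ f (f′ ∷ fs) x⊆V x∈links =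
    ∧-true⁺ (∧-true⁺ (x∈links f (here refl)) (⊆ᵇ⁺ (p∩q⊆p _ _ ∘ x⊆V)))
            (∧-true⁺ (commonLink-mem⁺ f′ fs (p∩q⊆q _ _ ∘ x⊆V) (λ g → x∈links g ∘ there)) (⊆ᵇ⁺ x⊆V))

  commonLink-V⊆ : ∀ f fs g → g ∈ₗ f ∷ fs → V (commonLink G (f ∷ fs)) ⊆ V G ─ g
  commonLink-V⊆ f []        _ (here refl) = λ y∈ → y∈
  commonLink-V⊆ f (_ ∷ _)   _ (here refl) = p∩q⊆p _ _
  commonLink-V⊆ f (f′ ∷ fs) g (there g∈)  = commonLink-V⊆ f′ fs g g∈ ∘ p∩q⊆q _ _

  commonLink-V⁺ : ∀ f fs {y} → y ∈ V G → (∀ g → g ∈ₗ f ∷ fs → y ∉ g) → y ∈ V (commonLink G (f ∷ fs))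
  commonLink-V⁺ f []        y∈V y∉F = x∈p∧x∉q⇒x∈p─q y∈V (y∉F f (here refl))
  commonLink-V⁺ f (f′ ∷ fs) y∈V y∉F =
    x∈p∩q⁺ (x∈p∧x∉q⇒x∈p─q y∈V (y∉F f (here refl)) , commonLink-V⁺ f′ fs y∈V (λ g → y∉F g ∘ there))

  ⊆⋃ : ∀ {F : List (Subset N)} {g} → g ∈ₗ F → g ⊆ ⋃ F
  ⊆⋃ {f ∷ F} (here refl) = p⊆p∪q (⋃ F)
  ⊆⋃ {f ∷ F} (there g∈F) = q⊆p∪q f (⋃ F) ∘ ⊆⋃ g∈F

  ∣⋃∣≤ : ∀ (F : List (Subset N)) {i} → (∀ g → g ∈ₗ F → ∣ g ∣ ≡ i) → ∣ ⋃ F ∣ ≤ length F * i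
  ∣⋃∣≤ []      _    = ≤-reflexive (∣⊥∣≡0 N)
  ∣⋃∣≤ (f ∷ F) ∣F∣≡i = ≤-trans (∣p∪q∣≤∣p∣+∣q∣ f (⋃ F))
    (+-mono-≤ (≤-reflexive (∣F∣≡i f (here refl))) (∣⋃∣≤ F (λ g → ∣F∣≡i g ∘ there)))

  commonLink-size : ∀ f fs {i} → (∀ g → g ∈ₗ f ∷ fs → ∣ g ∣ ≡ i) →
    nV G ≤ nV (commonLink G (f ∷ fs)) + length (f ∷ fs) * i
  commonLink-size f fs ∣F∣≡i = begin
    ∣ V G ∣                    ≤⟨ p⊆q⇒∣p∣≤∣q∣ V⊆ ⟩
    ∣ V G′ ∪ ⋃ (f ∷ fs) ∣      ≤⟨ ∣p∪q∣≤∣p∣+∣q∣ (V G′) (⋃ (f ∷ fs)) ⟩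
    ∣ V G′ ∣ + ∣ ⋃ (f ∷ fs) ∣  ≤⟨ +-monoʳ-≤ ∣ V G′ ∣ (∣⋃∣≤ (f ∷ fs) ∣F∣≡i) ⟩
    ∣ V G′ ∣ + length (f ∷ fs) * _ ∎
    where
    open ≤-Reasoning
    G′ = commonLink G (f ∷ fs)
    V⊆ : V G ⊆ V G′ ∪ ⋃ (f ∷ fs)
    V⊆ {y} y∈V with y ∈? ⋃ (f ∷ fs)
    ... | yes y∈F = q⊆p∪q (V G′) _ y∈F
    ... | no  y∉F = p⊆p∪q _ (commonLink-V⁺ f fs y∈V (λ g g∈F y∈g → y∉F (⊆⋃ g∈F y∈g)))

open CommonLinks

commonLink-V-cong : ∀ {N} {G G′ : Cx N} → V G′ ≡ V G → ∀ F → V (commonLink G′ F) ≡ V (commonLink G F)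
commonLink-V-cong V≡ []                = refl
commonLink-V-cong V≡ (f ∷ [])          = cong (_─ f) V≡
commonLink-V-cong {G = G} {G′} V≡ (f ∷ F@(_ ∷ _)) =
  cong₂ _∩_ (cong (_─ f) V≡) (commonLink-V-cong {G = G} {G′} V≡ F)

commonLink-deletion : ∀ {N} (G : Cx N) H f fs →
  Deletion H (f ∷ fs) (commonLink G (f ∷ fs)) (commonLink (G minus H) (f ∷ fs))
commonLink-deletion G H f fs = record
  { spanning      = record { V-≡ = V≡ ; mem-⊆ = kept⇒edge }
  ; deleted-spans = deleted-spans
  ; kept-avoids   = λ x x∈ g g∈F h Hh → minus-avoids {G = G} (commonLink-mem⁻ (G minus H) f fs x∈ g g∈F) Hh
  }
  where
  V≡ : V (commonLink (G minus H) (f ∷ fs)) ≡ V (commonLink G (f ∷ fs))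
  V≡ = commonLink-V-cong {G = G} {G′ = G minus H} refl (f ∷ fs)

  kept⇒edge : ∀ x → mem (commonLink (G minus H) (f ∷ fs)) x ≡ true → mem (commonLink G (f ∷ fs)) x ≡ true
  kept⇒edge x x∈ = commonLink-mem⁺ G f fs (subst (x ⊆_) V≡ (commonLink-mem⊆V (G minus H) f fs x∈))
    (λ g g∈F → minus-mem⁻ {G = G} (commonLink-mem⁻ (G minus H) f fs x∈ g g∈F))

  deleted-spans : ∀ x → x ⊆ V (commonLink G (f ∷ fs)) → mem (commonLink G (f ∷ fs)) x ≡ true →
    mem (commonLink (G minus H) (f ∷ fs)) x ≡ false → ∃ λ g → g ∈ₗ f ∷ fs × ∃ λ h → H h ≡ true × h ⊆ g ∪ x
  deleted-spans x x⊆V x∈ x∉ with all (λ g → mem (G minus H) (g ∪ x)) (f ∷ fs) in all-kept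
  ... | true with () ← trans (sym x∉) (commonLink-mem⁺ (G minus H) f fs (subst (x ⊆_) (sym V≡) x⊆V)
                                         (λ g → all-true⁻ (λ g → mem (G minus H) (g ∪ x)) all-kept))
  ... | false = let g , g∈F , g∪x∉ = all-false⁻ _ (f ∷ fs) all-kept
                    h , Hh , h⊆g∪x = minus-deleted {G = G} (commonLink-mem⁻ G f fs x∈ g g∈F) g∪x∉
                in g , g∈F , h , Hh , h⊆g∪x

module Scalings where

  open import Data.Nat using (_+_; _*_; _≤_)
  open import Data.Nat.Properties
  open import Data.Nat.Solver using (module +-*-Solver)
  open +-*-Solver
  open ≤-Reasoning

  whole-scaling : ∀ r n t → 1 ≤ t → 1 * 2 ^ (0 + r) * (n * n ^ (t ∸ 1)) ≤ 2 ^ r * n ^ t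
  whole-scaling r n (suc t) _ = ≤-reflexive (cong (_* (n * n ^ t)) (*-identityˡ (2 ^ r)))

  -- n ≥ r 2 ^ (r + 1) guarantees that removing at most 2 ^ r · r vertices keeps m ≥ n / 2
  link-scaling : ∀ r i L n m t → i ≤ r → L ≤ 2 ^ i → r * 2 ^ (r + 1) ≤ n → n ≤ m + L * i → 1 ≤ t →
    L * 2 ^ (i + (r ∸ i)) * (n * m ^ (t ∸ 1)) ≤ 2 ^ (2 * r + 1) * m ^ t
  link-scaling r i L n m (suc t) i≤r L≤2^i r2^[r+1]≤n n≤m+Li _ = begin
    L * 2 ^ (i + (r ∸ i)) * (n * m ^ t)   ≡⟨ cong (λ e → L * 2 ^ e * (n * m ^ t)) (m+[n∸m]≡n i≤r) ⟩
    L * 2 ^ r * (n * m ^ t)               ≤⟨ *-mono-≤ (*-monoˡ-≤ (2 ^ r) L≤2^r) (*-monoˡ-≤ (m ^ t) n≤m+m) ⟩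
    2 ^ r * 2 ^ r * ((m + m) * m ^ t)     ≡⟨ solve 3 (λ A M P → A :* A :* ((M :+ M) :* P) := A :* A :* con 2 :* (M :* P))
                                                    refl (2 ^ r) m (m ^ t) ⟩
    2 ^ r * 2 ^ r * 2 * (m * m ^ t)       ≡⟨ cong (_* (m * m ^ t)) (sym 2^[2r+1]) ⟩
    2 ^ (2 * r + 1) * m ^ suc t           ∎
    where
    a = r * 2 ^ r
    L≤2^r : L ≤ 2 ^ r
    L≤2^r = ≤-trans L≤2^i (^-monoʳ-≤ 2 i≤r)
    n≤m+a : n ≤ m + a
    n≤m+a = ≤-trans n≤m+Li (+-monoʳ-≤ m (≤-trans (*-mono-≤ L≤2^r i≤r) (≤-reflexive (*-comm (2 ^ r) r))))
    a+a≤n : a + a ≤ n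
    a+a≤n = subst (_≤ n) (trans (cong (r *_) (trans (^-distribˡ-+-* 2 r 1) (*-comm (2 ^ r) 2)))
                                (solve 2 (λ R A → R :* (con 2 :* A) := R :* A :+ R :* A) refl r (2 ^ r))) r2^[r+1]≤n
    n≤m+m : n ≤ m + m
    n≤m+m = ≤-trans n≤m+a (+-monoʳ-≤ m (+-cancelʳ-≤ a a m (≤-trans a+a≤n n≤m+a)))
    2^[2r+1] : 2 ^ (2 * r + 1) ≡ 2 ^ r * 2 ^ r * 2
    2^[2r+1] = trans (^-distribˡ-+-* 2 (2 * r) 1)
                     (cong (_* 2) (trans (cong (2 ^_) (solve 1 (λ R → con 2 :* R := R :+ R) refl r))
                                         (^-distribˡ-+-* 2 r r)))

open Scalings
open import Data.Nat using (_<_; _≤_)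
open import Data.Rational using (_+_; _-_; _*_)

module MinusDeletion {N} {q r′ r : ℕ} (r<q : r < q) (r≤r′ : r ≤ r′) {γ : ℚ} (0≤γ : 0ℚ ℚ.≤ γ)
                     {G : Cx N} (n-large : r ℕ.* 2 ^ (r ℕ.+ 1) ≤ nV G)
                     {H : Subset N → Bool} (H-on-V : IsGraphOn r′ H (V G)) (max-codegree : MaxDegLe r′ H (V G) γ) where

  import Data.List.Relation.Unary.All as All
  open import Data.Fin.Subset.Properties using (∣⊥∣≡0; ⊥⊆; ∉⊥)
  open import Data.Nat.Properties using (∸-monoˡ-<; m+[n∸m]≡n)
  open IntegralCodegreeBound (codegree-bound r′ H (V G) 0≤γ max-codegree)

  private
    ∅-sized : ∀ f → f ∈ₗ ∅ ∷ [] → ∣ f ∣ ≡ 0 × f ⊆ V G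
    ∅-sized _ (here refl) = ∣⊥∣≡0 N , ⊥⊆

    ∅∩V≡∅ : ∀ f → f ∈ₗ ∅ ∷ [] → ∀ {y} → y ∈ V G → y ∉ f
    ∅∩V≡∅ _ (here refl) _ = ∉⊥

    module WholeDeletions = Deletions r′ H (V G) H-on-V γ 0≤γ D codegree≤D D≤γ∣W∣ (∅ ∷ []) 0 ∅-sized
    module Whole = WholeDeletions.Losses.Bounds (minus-deletion G H) id ∅∩V≡∅ (2 ^ r) r (whole-scaling r (nV G))

  regular-minus : ∀ {ε d} → Regular ε d q r G → Regular (ε + ℕ→ℚ (2 ^ r) * γ) d q r (G minus H)
  regular-minus {ε} {d} = Whole.regular-deletion {ε} {d} r<q

  dense-minus : ∀ {ξ} → Dense ξ q r G → Dense (ξ - ℕ→ℚ (2 ^ r) * γ) q r (G minus H)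
  dense-minus {ξ} = Whole.dense-deletion {ξ} r<q

  extendable-minus : ∀ {ξ} → Extendable ξ q r G → Extendable (ξ - ℕ→ℚ (2 ^ r) * γ) q r (G minus H)
  extendable-minus {ξ} = Whole.extendable-deletion {ξ} r<q r≤r′

  epsComplex-minus : ∀ {ε ξ} → EpsComplex ε ξ q r G →
    EpsComplex (ε + ℕ→ℚ (2 ^ r) * γ) (ξ - ℕ→ℚ (2 ^ r) * γ) q r (G minus H)
  epsComplex-minus {ε} {ξ} = WholeDeletions.epsComplex-deletion (minus-deletion G H) id ∅∩V≡∅ (2 ^ r) r
    (whole-scaling r (nV G)) {ε} {ξ} r<q r≤r′

  supercomplex-minus : ∀ {ε ξ} → Supercomplex ε ξ q r G →
    Supercomplex (ε + ℕ→ℚ (2 ^ (2 ℕ.* r ℕ.+ 1)) * γ) (ξ - ℕ→ℚ (2 ^ (2 ℕ.* r ℕ.+ 1)) * γ) q r (G minus H)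
  supercomplex-minus {ε} {ξ} super i i≤r (f ∷ fs) unique F-edges 1≤∣F∣ ∣F∣≤2^i =
    LinkDeletions.epsComplex-deletion (commonLink-deletion G H f fs)
      (p─q⊆p (V G) f ∘ commonLink-V⊆ G f fs f (here refl)) F∩V≡∅ (2 ^ (2 ℕ.* r ℕ.+ 1)) (r ∸ i) scaling
      {ε} {ξ} (∸-monoˡ-< r<q i≤r) (subst (_≤ r′) (sym (m+[n∸m]≡n i≤r)) r≤r′)
      (super i i≤r (f ∷ fs) unique (All.map G-edge F-edges) 1≤∣F∣ ∣F∣≤2^i)
    where
    G-edge : ∀ {g} → Edge (G minus H) g × ∣ g ∣ ≡ i → Edge G g × ∣ g ∣ ≡ i
    G-edge ((g∈G−H , g⊆V) , ∣g∣≡i) = (minus-mem⁻ {G = G} g∈G−H , g⊆V) , ∣g∣≡i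
    F-sized : ∀ g → g ∈ₗ f ∷ fs → ∣ g ∣ ≡ i × g ⊆ V G
    F-sized g g∈F = let (_ , g⊆V) , ∣g∣≡i = All.lookup F-edges g∈F in ∣g∣≡i , g⊆V
    F∩V≡∅ : ∀ g → g ∈ₗ f ∷ fs → ∀ {y} → y ∈ V (commonLink G (f ∷ fs)) → y ∉ g
    F∩V≡∅ g g∈F y∈V = proj₂ (x∈p─q⁻ (V G) g (commonLink-V⊆ G f fs g g∈F y∈V))
    module LinkDeletions = Deletions r′ H (V G) H-on-V γ 0≤γ D codegree≤D D≤γ∣W∣ (f ∷ fs) i F-sized
    scaling : LinkDeletions.Scaling (2 ^ (2 ℕ.* r ℕ.+ 1)) (r ∸ i) (commonLink G (f ∷ fs))
    scaling t = link-scaling r i (length (f ∷ fs)) (nV G) (nV (commonLink G (f ∷ fs))) t i≤r ∣F∣≤2^i n-large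
      (commonLink-size G f fs (λ g → proj₁ ∘ F-sized g))

proposition5p6 : (N q r' r : ℕ) → 1 ≤ q → 1 ≤ r' → r < q → r ≤ r' →
    (ε d ξ γ : ℚ) → 0ℚ ℚ.≤ ε → 0ℚ ℚ.≤ d → 0ℚ ℚ.≤ ξ → 0ℚ ℚ.≤ γ →
    (G : Cx N) → IsComplex G → r ℕ.* 2 ^ (r ℕ.+ 1) ≤ nV G →
    (H : Subset N → Bool) → IsGraphOn r' H (V G) → MaxDegLe r' H (V G) γ →
      (Regular ε d q r G → Regular (ε + ℕ→ℚ (2 ^ r) * γ) d q r (G minus H))
    × (Dense ξ q r G → Dense (ξ - ℕ→ℚ (2 ^ r) * γ) q r (G minus H))
    × (Extendable ξ q r G → Extendable (ξ - ℕ→ℚ (2 ^ r) * γ) q r (G minus H))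
    × (EpsComplex ε ξ q r G →
        EpsComplex (ε + ℕ→ℚ (2 ^ r) * γ) (ξ - ℕ→ℚ (2 ^ r) * γ) q r (G minus H))
    × (Supercomplex ε ξ q r G →
        Supercomplex (ε + ℕ→ℚ (2 ^ (2 ℕ.* r ℕ.+ 1)) * γ) (ξ - ℕ→ℚ (2 ^ (2 ℕ.* r ℕ.+ 1)) * γ) q r (G minus H))
proposition5p6 N q r′ r _ _ r<q r≤r′ ε d ξ γ _ _ _ 0≤γ G _ n-large H H-on-V max-codegree =
  regular-minus {ε} {d} , dense-minus {ξ} , extendable-minus {ξ} , epsComplex-minus {ε} {ξ} , supercomplex-minus {ε} {ξ}
  where open MinusDeletion r<q r≤r′ 0≤γ n-large H-on-V max-codegree
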